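{- Let $k,t\ge1$ and $\lambda=(k^t)$. Then for $n\ge0$, \[ \mathrm{ehr}(\mathcal{O}(P_\lambda),n)=\prod_{i=0}^{k-1}\binom{n+t+k-1}{n+i}\frac{i!}{(n+t+k-i-1)^{k-i-1}}. \]
   Context: For a partition $\lambda$, the Ferrers poset $P_\lambda$ has as elements the cells $(i,j)$, $1\le j\le\lambda_i$, ordered by $(i,j)\preceq(i',j')$ iff $i'\le i$ and $j'\le j$; for $\lambda=(k^t)$ this is the product of a $t$-element chain and a $k$-element chain. For a finite poset $P$, the order polytope $\mathcal{O}(P)\subset\mathbb{R}^P$ is defined by $0\le x_s\le1$ and $x_s\le x_{s'}$ whenever $s\prec s'$; $\mathrm{ehr}(\mathcal{O}(P),n)=|n\mathcal{O}(P)\cap\mathbb{Z}^P|$ for $n\ge1$, $=1$ for $n=0$. Equivalently, $\mathrm{ehr}(\mathcal{O}(P_{(k^t)}),n)$ is the number of $t\times k$ matrices with entries in $\{0,\dots,n\}$ whose rows and columns are weakly monotone (same direction). -}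

module Defs where

open import Data.Nat using (ℕ; zero; suc; _+_; _∸_; _^_; _≤ᵇ_)
open import Data.Nat using (_!)
open import Data.Nat.Combinatorics using (_C_)
open import Data.Nat.ListAction using (sum)
open import Data.Fin using (Fin; toℕ)
open import Data.List using (List; []; _∷_; map; concatMap; allFin; upTo; foldr; cartesianProduct)
open import Data.Vec using (Vec; lookup) renaming ([] to []ᵛ; _∷_ to _∷ᵛ_)
open import Data.Product using (_×_; _,_)
import Data.Bool
open import Data.Bool using (Bool; _∧_; _∨_; not; if_then_else_)
open import Data.Integer using (+_)
open import Data.Rational using (ℚ; _/_; 0ℚ; 1ℚ; _*_)

allVecs : {A : Set} → List A → (m : ℕ) → List (Vec A m)
allVecs xs zero = []ᵛ ∷ []
allVecs xs (suc m) = concatMap (λ x → map (x ∷ᵛ_) (allVecs xs m)) xs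

all : {A : Set} → (A → Bool) → List A → Bool
all p = foldr (λ a b → p a ∧ b) Data.Bool.true

-- Cells of the Ferrers poset P_(k^t): pairs (i , j), i : Fin t (row), j : Fin k (column).
Cell : ℕ → ℕ → Set
Cell t k = Fin t × Fin k

cells : (t k : ℕ) → List (Cell t k)
cells t k = cartesianProduct (allFin t) (allFin k)

_≼ᵇ_ : {t k : ℕ} → Cell t k → Cell t k → Bool
(i , j) ≼ᵇ (i' , j') = (toℕ i' ≤ᵇ toℕ i) ∧ (toℕ j' ≤ᵇ toℕ j)

Labelling : ℕ → ℕ → ℕ → Set
Labelling t k n = Vec (Vec (Fin (suc n)) k) t

val : {t k n : ℕ} → Labelling t k n → Cell t k → ℕ
val x (i , j) = toℕ (lookup (lookup x i) j)

-- x ∈ n·O(P) ∩ ℤ^P  iff  0 ≤ x_s ≤ n and x_s ≤ x_s' whenever s ≼ s'.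
inOrderPolytope : {t k n : ℕ} → Labelling t k n → Bool
inOrderPolytope {t} {k} x =
  all (λ s → all (λ s' → not (s ≼ᵇ s') ∨ (val x s ≤ᵇ val x s')) (cells t k)) (cells t k)

-- ehr(O(P_(k^t)), n) = number of lattice points of n·O(P) (this is 1 for n = 0).
ehrRect : (t k n : ℕ) → ℕ
ehrRect t k n =
  sum (map (λ x → if inOrderPolytope x then 1 else 0)
           (allVecs (allVecs (allFin (suc n)) k) t))

-- Division of naturals in ℚ (denominator 0 is sent to 0; never used at 0 below).
_/ℕ_ : ℕ → ℕ → ℚ
a /ℕ zero = 0ℚ
a /ℕ suc d = (+ a) / suc d

prodℚ : ℕ → (ℕ → ℚ) → ℚ
prodℚ m f = foldr (λ i acc → f i * acc) 1ℚ (upTo m)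

rectFormula : (t k n : ℕ) → ℚ
rectFormula t k n = prodℚ k (λ i →
  ((+ ((n + t + k ∸ 1) C (n + i))) / 1)
  * ((i !) /ℕ ((n + t + k ∸ i ∸ 1) ^ (k ∸ i ∸ 1))))

{-# OPTIONS --safe #-}
-- Read along its anti-diagonals, a monotone t × k matrix with entries in {0, …, n}, bordered by a row
-- of n's above and columns of 0's to the right, is a Gelfand–Tsetlin pattern with top row
-- (n, …, n, 0, …, 0) (k entries n, t zeros): consecutive diagonals interlace, and interlacing is
-- exactly monotonicity of the matrix. Summing out one row of a pattern at a time, the hockey-stick
-- identity and multilinearity of the determinant give #GT L β = ± det (C(β i + L - i, j)). For the
-- rectangular top row the last t rows of this matrix expand away, and scaling rows and columns
-- turns the rest into a Vandermonde determinant in falling factorials; the resulting identity of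
-- natural numbers is the stated product with its denominators cleared.
module Submission where

open import Data.Nat using (ℕ)

module Determinants where
  open import Data.Nat using (ℕ; zero; suc; z≤n; s≤s; _<_; _≤_)
  import Data.Nat.Properties as ℕ
  open import Data.Integer using (ℤ; -_; _+_; _*_; _-_; 0ℤ; 1ℤ)
  import Data.Integer.Properties as ℤ
  open import Data.Integer.Tactic.RingSolver using (solve-∀)
  open import Data.Bool using (true; false; if_then_else_)
  open import Data.Empty using (⊥-elim)
  open import Data.Sum using (_⊎_; inj₁; inj₂)
  open import Data.Product using (_×_; _,_)
  open import Function using (_∘_)
  open import Relation.Binary.PropositionalEquality
  open import Relation.Nullary using (does; yes; no)
  open import Relation.Nullary.Decidable using (dec-true; dec-false)

  Σℤ : ℕ → (ℕ → ℤ) → ℤ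
  Σℤ zero    f = 0ℤ
  Σℤ (suc m) f = f 0 + Σℤ m (f ∘ suc)

  syntax Σℤ m (λ i → e) = ∑[ i < m ] e

  Πℤ : ℕ → (ℕ → ℤ) → ℤ
  Πℤ zero    f = 1ℤ
  Πℤ (suc m) f = f 0 * Πℤ m (f ∘ suc)

  Σℤ-cong : ∀ m {f g : ℕ → ℤ} → (∀ i → i < m → f i ≡ g i) → Σℤ m f ≡ Σℤ m g
  Σℤ-cong zero    f≡g = refl
  Σℤ-cong (suc m) f≡g = cong₂ _+_ (f≡g 0 (s≤s z≤n)) (Σℤ-cong m (λ i i<m → f≡g (suc i) (s≤s i<m)))

  Σℤ-zero : ∀ m {f : ℕ → ℤ} → (∀ i → i < m → f i ≡ 0ℤ) → Σℤ m f ≡ 0ℤ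
  Σℤ-zero zero    f≡0 = refl
  Σℤ-zero (suc m) f≡0 = cong₂ _+_ (f≡0 0 (s≤s z≤n)) (Σℤ-zero m (λ i i<m → f≡0 (suc i) (s≤s i<m)))

  Σℤ-*ˡ : ∀ m a (f : ℕ → ℤ) → ∑[ i < m ] (a * f i) ≡ a * Σℤ m f
  Σℤ-*ˡ zero    a f = sym (ℤ.*-zeroʳ a)
  Σℤ-*ˡ (suc m) a f = trans (cong (a * f 0 +_) (Σℤ-*ˡ m a (f ∘ suc))) (sym (ℤ.*-distribˡ-+ a (f 0) _))

  Σℤ-linear : ∀ m α β (f g : ℕ → ℤ) → ∑[ i < m ] (α * f i + β * g i) ≡ α * Σℤ m f + β * Σℤ m g
  Σℤ-linear zero    α β f g = sym (cong₂ _+_ (ℤ.*-zeroʳ α) (ℤ.*-zeroʳ β))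
  Σℤ-linear (suc m) α β f g =
    trans (cong (α * f 0 + β * g 0 +_) (Σℤ-linear m α β (f ∘ suc) (g ∘ suc))) (regroup α β _ _ _ _)
    where
    regroup : ∀ α β a b c d → (α * a + β * b) + (α * c + β * d) ≡ α * (a + c) + β * (b + d)
    regroup = solve-∀

  Σℤ-single : ∀ m k (f : ℕ → ℤ) → k < m → (∀ i → i < m → i ≢ k → f i ≡ 0ℤ) → Σℤ m f ≡ f k
  Σℤ-single (suc m) zero f _ rest≡0 =
    trans (cong (f 0 +_) (Σℤ-zero m (λ i i<m → rest≡0 (suc i) (s≤s i<m) λ ()))) (ℤ.+-identityʳ (f 0))
  Σℤ-single (suc m) (suc k) f (s≤s k<m) rest≡0 =
    trans (cong (_+ Σℤ m (f ∘ suc)) (rest≡0 0 (s≤s z≤n) λ ())) (trans (ℤ.+-identityˡ _)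
          (Σℤ-single m k (f ∘ suc) k<m (λ i i<m i≢k → rest≡0 (suc i) (s≤s i<m) (i≢k ∘ ℕ.suc-injective))))

  Σℤ-cancelPair : ∀ m r (f : ℕ → ℤ) → suc r < m → f r + f (suc r) ≡ 0ℤ →
                  (∀ i → i < m → i ≢ r → i ≢ suc r → f i ≡ 0ℤ) → Σℤ m f ≡ 0ℤ
  Σℤ-cancelPair (suc (suc m)) zero f _ pair≡0 rest≡0 = begin
    f 0 + (f 1 + Σℤ m (f ∘ suc ∘ suc))  ≡⟨ ℤ.+-assoc (f 0) (f 1) _ ⟨
    (f 0 + f 1) + Σℤ m (f ∘ suc ∘ suc)  ≡⟨ cong₂ _+_ pair≡0 (Σℤ-zero m (λ i i<m → rest≡0 (suc (suc i)) (s≤s (s≤s i<m)) (λ ()) (λ ()))) ⟩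
    0ℤ                                  ∎
    where open ≡-Reasoning
  Σℤ-cancelPair (suc m) (suc r) f (s≤s r<m) pair≡0 rest≡0 =
    cong₂ _+_ (rest≡0 0 (s≤s z≤n) (λ ()) (λ ()))
              (Σℤ-cancelPair m r (f ∘ suc) r<m pair≡0
                 (λ i i<m i≢r i≢r+1 → rest≡0 (suc i) (s≤s i<m) (i≢r ∘ ℕ.suc-injective) (i≢r+1 ∘ ℕ.suc-injective)))

  sign : ℕ → ℤ
  sign zero    = 1ℤ
  sign (suc i) = - sign i

  punchIn : ℕ → ℕ → ℕ
  punchIn zero    p       = suc p
  punchIn (suc i) zero    = zero
  punchIn (suc i) (suc p) = suc (punchIn i p)

  punchOut : ℕ → ℕ → ℕ
  punchOut zero    zero    = zero
  punchOut zero    (suc r) = r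
  punchOut (suc i) zero    = zero
  punchOut (suc i) (suc r) = suc (punchOut i r)

  punchInᵢ≢i : ∀ i p → punchIn i p ≢ i
  punchInᵢ≢i (suc i) (suc p) eq = punchInᵢ≢i i p (ℕ.suc-injective eq)

  punchIn-punchOut : ∀ i r → i ≢ r → punchIn i (punchOut i r) ≡ r
  punchIn-punchOut zero    zero    i≢r = ⊥-elim (i≢r refl)
  punchIn-punchOut zero    (suc r) i≢r = refl
  punchIn-punchOut (suc i) zero    i≢r = refl
  punchIn-punchOut (suc i) (suc r) i≢r = cong suc (punchIn-punchOut i r (i≢r ∘ cong suc))

  punchIn-injective : ∀ i p q → punchIn i p ≡ punchIn i q → p ≡ q
  punchIn-injective zero    p       q       eq = ℕ.suc-injective eq
  punchIn-injective (suc i) zero    zero    eq = refl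
  punchIn-injective (suc i) (suc p) (suc q) eq = cong suc (punchIn-injective i p q (ℕ.suc-injective eq))

  punchIn-< : ∀ m i p → i < suc m → p < m → punchIn i p < suc m
  punchIn-< m       zero    p       _           p<m       = s≤s p<m
  punchIn-< (suc m) (suc i) zero    _           _         = s≤s z≤n
  punchIn-< (suc m) (suc i) (suc p) (s≤s i<m+1) (s≤s p<m) = s≤s (punchIn-< m i p i<m+1 p<m)

  punchIn-below : ∀ i p → p < i → punchIn i p ≡ p
  punchIn-below (suc i) zero    _         = refl
  punchIn-below (suc i) (suc p) (s≤s p<i) = cong suc (punchIn-below i p p<i)

  punchIn-above : ∀ i p → i ≤ p → punchIn i p ≡ suc p
  punchIn-above zero    p       _         = refl
  punchIn-above (suc i) (suc p) (s≤s i≤p) = cong suc (punchIn-above i p i≤p)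

  punchIn-adjacent : ∀ r p → punchIn r p ≡ punchIn (suc r) p ⊎ (punchIn r p ≡ suc r × punchIn (suc r) p ≡ r)
  punchIn-adjacent zero    zero    = inj₂ (refl , refl)
  punchIn-adjacent zero    (suc p) = inj₁ refl
  punchIn-adjacent (suc r) zero    = inj₁ refl
  punchIn-adjacent (suc r) (suc p) with punchIn-adjacent r p
  ... | inj₁ eq          = inj₁ (cong suc eq)
  ... | inj₂ (eq₁ , eq₂) = inj₂ (cong suc eq₁ , cong suc eq₂)

  punchOut-< : ∀ m i r → i < suc m → r < suc m → i ≢ r → punchOut i r < m
  punchOut-< m       zero    zero    _           _           i≢r = ⊥-elim (i≢r refl)
  punchOut-< m       zero    (suc r) _           (s≤s r<m)   _   = r<m
  punchOut-< zero    (suc i) _       (s≤s ())    _           _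
  punchOut-< (suc m) (suc i) zero    _           _           _   = s≤s z≤n
  punchOut-< (suc m) (suc i) (suc r) (s≤s i<m+1) (s≤s r<m+1) i≢r = s≤s (punchOut-< m i r i<m+1 r<m+1 (i≢r ∘ cong suc))

  punchOut-suc : ∀ i r → i ≢ r → i ≢ suc r → punchOut i (suc r) ≡ suc (punchOut i r)
  punchOut-suc zero          zero    i≢r _     = ⊥-elim (i≢r refl)
  punchOut-suc zero          (suc r) _   _     = refl
  punchOut-suc (suc zero)    zero    _   i≢r+1 = ⊥-elim (i≢r+1 refl)
  punchOut-suc (suc (suc i)) zero    _   _     = refl
  punchOut-suc (suc i)       (suc r) i≢r i≢r+1 = cong suc (punchOut-suc i r (i≢r ∘ cong suc) (i≢r+1 ∘ cong suc))

  -- Only the top-left m × m block of a matrix enters det m, which is expanded along column 0;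
  -- minor A i deletes row i and column 0.
  Matrix : Set
  Matrix = ℕ → ℕ → ℤ

  minor : Matrix → ℕ → Matrix
  minor A i p c = A (punchIn i p) (suc c)

  det : ℕ → Matrix → ℤ
  det zero    A = 1ℤ
  det (suc m) A = ∑[ i < suc m ] (sign i * (A i 0 * det m (minor A i)))

  det-cong : ∀ m {A B : Matrix} → (∀ p c → p < m → A p c ≡ B p c) → det m A ≡ det m B
  det-cong zero    A≡B = refl
  det-cong (suc m) A≡B = Σℤ-cong (suc m) λ i i<m+1 →
    cong₂ (λ a d → sign i * (a * d)) (A≡B i 0 i<m+1)
          (det-cong m (λ p c p<m → A≡B (punchIn i p) (suc c) (punchIn-< m i p i<m+1 p<m)))

  setRow : Matrix → ℕ → (ℕ → ℤ) → Matrix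
  setRow A r v p = if does (p ℕ.≟ r) then v else A p

  setRow-same : ∀ A r v → setRow A r v r ≡ v
  setRow-same A r v rewrite dec-true (r ℕ.≟ r) refl = refl

  setRow-other : ∀ A r v p → p ≢ r → setRow A r v p ≡ A p
  setRow-other A r v p p≢r rewrite dec-false (p ℕ.≟ r) p≢r = refl

  setRow-cong : ∀ A r {v w : ℕ → ℤ} → (∀ c → v c ≡ w c) → ∀ p c → setRow A r v p c ≡ setRow A r w p c
  setRow-cong A r v≡w p c with does (p ℕ.≟ r)
  ... | true  = v≡w c
  ... | false = refl

  setRow-self : ∀ A r p → setRow A r (A r) p ≡ A p
  setRow-self A r p with p ℕ.≟ r
  ... | yes refl = setRow-same A p (A p)
  ... | no  p≢r  = setRow-other A r (A r) p p≢r

  minor-setRow-same : ∀ A r v p c → minor (setRow A r v) r p c ≡ minor A r p c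
  minor-setRow-same A r v p c = cong (λ row → row (suc c)) (setRow-other A r v (punchIn r p) (punchInᵢ≢i r p))

  minor-setRow-other : ∀ A i r v → i ≢ r → ∀ p c →
                       minor (setRow A r v) i p c ≡ setRow (minor A i) (punchOut i r) (v ∘ suc) p c
  minor-setRow-other A i r v i≢r p c with p ℕ.≟ punchOut i r
  ... | yes refl = trans (cong (λ row → row (suc c)) (trans (cong (setRow A r v) (punchIn-punchOut i r i≢r)) (setRow-same A r v)))
                         (sym (cong (λ row → row c) (setRow-same (minor A i) p (v ∘ suc))))
  ... | no  p≢r′ = trans (cong (λ row → row (suc c)) (setRow-other A r v (punchIn i p) λ eq →
                     p≢r′ (punchIn-injective i p (punchOut i r) (trans eq (sym (punchIn-punchOut i r i≢r))))))
                         (sym (cong (λ row → row c) (setRow-other (minor A i) (punchOut i r) (v ∘ suc) p p≢r′)))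

  det-linear : ∀ m r (A : Matrix) α β (u w : ℕ → ℤ) → r < m →
               det m (setRow A r (λ c → α * u c + β * w c)) ≡ α * det m (setRow A r u) + β * det m (setRow A r w)
  det-linear (suc m) r A α β u w r<m =
    trans (Σℤ-cong (suc m) term) (Σℤ-linear (suc m) α β (summand u) (summand w))
    where
    summand : (ℕ → ℤ) → ℕ → ℤ
    summand v i = sign i * (setRow A r v i 0 * det m (minor (setRow A r v) i))
    term : ∀ i → i < suc m → summand (λ c → α * u c + β * w c) i ≡ α * summand u i + β * summand w i
    term i i<m+1 with i ℕ.≟ r
    ... | yes refl = trans (unfold (λ c → α * u c + β * w c)) (trans (distrib (sign i) α β (u 0) (w 0) _)
                       (sym (cong₂ (λ x y → α * x + β * y) (unfold u) (unfold w))))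
      where
      unfold : ∀ v → summand v i ≡ sign i * (v 0 * det m (minor A i))
      unfold v = cong₂ (λ a d → sign i * (a * d)) (cong (λ row → row 0) (setRow-same A i v))
                       (det-cong m (λ p c _ → minor-setRow-same A i v p c))
      distrib : ∀ s α β a b d → s * ((α * a + β * b) * d) ≡ α * (s * (a * d)) + β * (s * (b * d))
      distrib = solve-∀
    ... | no i≢r = trans (unfold (λ c → α * u c + β * w c))
            (trans (cong (λ d → sign i * (A i 0 * d))
                     (det-linear m (punchOut i r) (minor A i) α β (u ∘ suc) (w ∘ suc) (punchOut-< m i r i<m+1 r<m i≢r)))
            (trans (distrib (sign i) (A i 0) α β _ _) (sym (cong₂ (λ x y → α * x + β * y) (unfold u) (unfold w)))))
      where
      unfold : ∀ v → summand v i ≡ sign i * (A i 0 * det m (setRow (minor A i) (punchOut i r) (v ∘ suc)))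
      unfold v = cong₂ (λ a d → sign i * (a * d)) (cong (λ row → row 0) (setRow-other A r v i i≢r))
                       (det-cong m (λ p c _ → minor-setRow-other A i r v i≢r p c))
      distrib : ∀ s a α β x y → s * (a * (α * x + β * y)) ≡ α * (s * (a * x)) + β * (s * (a * y))
      distrib = solve-∀

  -- Expanding along column 0, the terms of rows r and r + 1 cancel and every other minor
  -- again has two equal adjacent rows.
  det-equalAdjacentRows : ∀ m r (A : Matrix) → suc r < m → (∀ c → A r c ≡ A (suc r) c) → det m A ≡ 0ℤ
  det-equalAdjacentRows (suc m) r A r+1<m rows≡ =
    Σℤ-cancelPair (suc m) r _ r+1<m pairCancels otherVanish
    where
    minors≡ : ∀ p c → minor A r p c ≡ minor A (suc r) p c
    minors≡ p c with punchIn-adjacent r p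
    ... | inj₁ eq          = cong (λ q → A q (suc c)) eq
    ... | inj₂ (eq₁ , eq₂) = trans (cong (λ q → A q (suc c)) eq₁)
                                   (trans (sym (rows≡ (suc c))) (cong (λ q → A q (suc c)) (sym eq₂)))
    pairCancels : sign r * (A r 0 * det m (minor A r)) + - sign r * (A (suc r) 0 * det m (minor A (suc r))) ≡ 0ℤ
    pairCancels = trans (cong₂ (λ a d → sign r * (A r 0 * det m (minor A r)) + - sign r * (a * d))
                               (sym (rows≡ 0)) (sym (det-cong m (λ p c _ → minors≡ p c))))
                        (cancel (sign r) (A r 0) (det m (minor A r)))
      where
      cancel : ∀ s a d → s * (a * d) + - s * (a * d) ≡ 0ℤ
      cancel = solve-∀
    otherVanish : ∀ i → i < suc m → i ≢ r → i ≢ suc r → sign i * (A i 0 * det m (minor A i)) ≡ 0ℤ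
    otherVanish i i<m+1 i≢r i≢r+1 =
      trans (cong (λ d → sign i * (A i 0 * d)) (det-equalAdjacentRows m (punchOut i r) (minor A i) bound rowsᵢ≡))
            (vanish (sign i) (A i 0))
      where
      suc-punchOut : punchOut i (suc r) ≡ suc (punchOut i r)
      suc-punchOut = punchOut-suc i r i≢r i≢r+1
      bound : suc (punchOut i r) < m
      bound = subst (_< m) suc-punchOut (punchOut-< m i (suc r) i<m+1 r+1<m i≢r+1)
      rowsᵢ≡ : ∀ c → minor A i (punchOut i r) c ≡ minor A i (suc (punchOut i r)) c
      rowsᵢ≡ c = trans (cong (λ q → A q (suc c)) (punchIn-punchOut i r i≢r))
                   (trans (rows≡ (suc c)) (cong (λ q → A q (suc c))
                     (sym (trans (cong (punchIn i) (sym suc-punchOut)) (punchIn-punchOut i (suc r) i≢r+1)))))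
      vanish : ∀ s a → s * (a * 0ℤ) ≡ 0ℤ
      vanish = solve-∀

  det-zeroRow : ∀ m r (A : Matrix) → r < m → (∀ c → A r c ≡ 0ℤ) → det m A ≡ 0ℤ
  det-zeroRow m r A r<m row≡0 = begin
    det m A                                                          ≡⟨ det-cong m asZeroCombination ⟩
    det m (setRow A r (λ c → 0ℤ * A r c + 0ℤ * A r c))               ≡⟨ det-linear m r A 0ℤ 0ℤ (A r) (A r) r<m ⟩
    0ℤ * det m (setRow A r (A r)) + 0ℤ * det m (setRow A r (A r))    ≡⟨ zeros (det m (setRow A r (A r))) (det m (setRow A r (A r))) ⟩
    0ℤ                                                               ∎
    where
    open ≡-Reasoning
    zeros : ∀ x y → 0ℤ * x + 0ℤ * y ≡ 0ℤ
    zeros = solve-∀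
    asZeroCombination : ∀ p c → p < m → A p c ≡ setRow A r (λ c → 0ℤ * A r c + 0ℤ * A r c) p c
    asZeroCombination p c _ with p ℕ.≟ r
    ... | yes refl = trans (row≡0 c) (sym (trans (cong (λ row → row c) (setRow-same A p _)) (zeros (A p c) (A p c))))
    ... | no  p≢r  = sym (cong (λ row → row c) (setRow-other A r _ p p≢r))

  det-subtractNextRow : ∀ m r (A : Matrix) → suc r < m → det m (setRow A r (λ c → A r c - A (suc r) c)) ≡ det m A
  det-subtractNextRow m r A r+1<m = begin
    det m (setRow A r (λ c → A r c - A (suc r) c))
      ≡⟨ det-cong m (λ p c _ → setRow-cong A r (λ c → asCombination (A r c) (A (suc r) c)) p c) ⟩
    det m (setRow A r (λ c → 1ℤ * A r c + - 1ℤ * A (suc r) c))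
      ≡⟨ det-linear m r A 1ℤ (- 1ℤ) (A r) (A (suc r)) (ℕ.<-trans (ℕ.n<1+n r) r+1<m) ⟩
    1ℤ * det m (setRow A r (A r)) + - 1ℤ * det m (setRow A r (A (suc r)))
      ≡⟨ cong₂ (λ x y → 1ℤ * x + - 1ℤ * y) (det-cong m (λ p c _ → cong (λ row → row c) (setRow-self A r p)))
               (det-equalAdjacentRows m r _ r+1<m duplicated) ⟩
    1ℤ * det m A + - 1ℤ * 0ℤ
      ≡⟨ simplify (det m A) ⟩
    det m A ∎
    where
    open ≡-Reasoning
    asCombination : ∀ a b → a - b ≡ 1ℤ * a + - 1ℤ * b
    asCombination = solve-∀
    simplify : ∀ d → 1ℤ * d + - 1ℤ * 0ℤ ≡ d
    simplify = solve-∀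
    duplicated : ∀ c → setRow A r (A (suc r)) r c ≡ setRow A r (A (suc r)) (suc r) c
    duplicated c = trans (cong (λ row → row c) (setRow-same A r _))
                         (sym (cong (λ row → row c) (setRow-other A r _ (suc r) ℕ.1+n≢n)))

  det-setRow-+ : ∀ m r (A : Matrix) (u w : ℕ → ℤ) → r < m →
                 det m (setRow A r (λ c → u c + w c)) ≡ det m (setRow A r u) + det m (setRow A r w)
  det-setRow-+ m r A u w r<m = begin
    det m (setRow A r (λ c → u c + w c))
      ≡⟨ det-cong m (λ p c _ → setRow-cong A r (λ c → sym (ones (u c) (w c))) p c) ⟩
    det m (setRow A r (λ c → 1ℤ * u c + 1ℤ * w c))
      ≡⟨ det-linear m r A 1ℤ 1ℤ u w r<m ⟩
    1ℤ * det m (setRow A r u) + 1ℤ * det m (setRow A r w)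
      ≡⟨ ones (det m (setRow A r u)) (det m (setRow A r w)) ⟩
    det m (setRow A r u) + det m (setRow A r w) ∎
    where
    open ≡-Reasoning
    ones : ∀ x y → 1ℤ * x + 1ℤ * y ≡ x + y
    ones = solve-∀

  det-sumRow : ∀ m r (A : Matrix) → r < m → ∀ cnt (h : ℕ → ℕ → ℤ) →
               det m (setRow A r (λ c → ∑[ d < cnt ] h d c)) ≡ ∑[ d < cnt ] det m (setRow A r (h d))
  det-sumRow m r A r<m zero      h = det-zeroRow m r _ r<m (λ c → cong (λ row → row c) (setRow-same A r _))
  det-sumRow m r A r<m (suc cnt) h =
    trans (det-setRow-+ m r A (h 0) (λ c → ∑[ d < cnt ] h (suc d) c) r<m)
          (cong (det m (setRow A r (h 0)) +_) (det-sumRow m r A r<m cnt (h ∘ suc)))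

  differences : Matrix → ℕ → Matrix
  differences A zero    = A
  differences A (suc k) = setRow (differences A k) k (λ c → A k c - A (suc k) c)

  differences-above : ∀ A k p → k ≤ p → differences A k p ≡ A p
  differences-above A zero    p _   = refl
  differences-above A (suc k) p k<p =
    trans (setRow-other (differences A k) k _ p (λ p≡k → ℕ.<⇒≢ k<p (sym p≡k))) (differences-above A k p (ℕ.<⇒≤ k<p))

  differences-below : ∀ A k p → p < k → ∀ c → differences A k p c ≡ A p c - A (suc p) c
  differences-below A (suc k) p p<k+1 c with p ℕ.≟ k
  ... | yes refl = cong (λ row → row c) (setRow-same (differences A p) p _)
  ... | no  p≢k  = trans (cong (λ row → row c) (setRow-other (differences A k) k _ p p≢k))
                         (differences-below A k p (ℕ.≤∧≢⇒< (ℕ.≤-pred p<k+1) p≢k) c)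

  det-differences : ∀ m A k → k < m → det m (differences A k) ≡ det m A
  det-differences m A zero    _     = refl
  det-differences m A (suc k) k+1<m = begin
    det m (setRow (differences A k) k (λ c → A k c - A (suc k) c))
      ≡⟨ det-cong m (λ p c _ → setRow-cong (differences A k) k (λ c → sym (cong₂ (λ x y → x c - y c)
           (differences-above A k k ℕ.≤-refl) (differences-above A k (suc k) (ℕ.n≤1+n k)))) p c) ⟩
    det m (setRow B k (λ c → B k c - B (suc k) c))
      ≡⟨ det-subtractNextRow m k B k+1<m ⟩
    det m B
      ≡⟨ det-differences m A k (ℕ.<-trans (ℕ.n<1+n k) k+1<m) ⟩
    det m A ∎
    where
    open ≡-Reasoning
    B = differences A k

  det-expandColumn0 : ∀ m (A : Matrix) → (∀ i → i < m → A i 0 ≡ 0ℤ) → det (suc m) A ≡ sign m * (A m 0 * det m (minor A m))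
  det-expandColumn0 m A column≡0 = Σℤ-single (suc m) m _ (ℕ.n<1+n m) vanish
    where
    vanish : ∀ i → i < suc m → i ≢ m → sign i * (A i 0 * det m (minor A i)) ≡ 0ℤ
    vanish i (s≤s i≤m) i≢m = trans (cong (λ a → sign i * (a * det m (minor A i))) (column≡0 i (ℕ.≤∧≢⇒< i≤m i≢m)))
                                   (zero* (sign i) (det m (minor A i)))
      where
      zero* : ∀ s d → s * (0ℤ * d) ≡ 0ℤ
      zero* = solve-∀

  det-expandLastRow : ∀ m (A : Matrix) → (∀ c → A m (suc c) ≡ 0ℤ) → det (suc m) A ≡ sign m * (A m 0 * det m (minor A m))
  det-expandLastRow zero    A _        = ℤ.+-identityʳ _
  det-expandLastRow (suc m) A row≡0 = Σℤ-single (suc (suc m)) (suc m) _ (ℕ.n<1+n (suc m)) vanish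
    where
    vanish : ∀ i → i < suc (suc m) → i ≢ suc m → sign i * (A i 0 * det (suc m) (minor A i)) ≡ 0ℤ
    vanish i (s≤s i≤m+1) i≢m+1 =
      trans (cong (λ d → sign i * (A i 0 * d)) (det-zeroRow (suc m) m (minor A i) (ℕ.n<1+n m) lastRow≡0))
            (*zero (sign i) (A i 0))
      where
      lastRow≡0 : ∀ c → minor A i m c ≡ 0ℤ
      lastRow≡0 c = trans (cong (λ q → A q (suc c)) (punchIn-above i m (ℕ.≤-pred (ℕ.≤∧≢⇒< i≤m+1 i≢m+1)))) (row≡0 c)
      *zero : ∀ s a → s * (a * 0ℤ) ≡ 0ℤ
      *zero = solve-∀

  det-scaleColumns : ∀ m (β : ℕ → ℤ) (A : Matrix) → det m (λ p c → β c * A p c) ≡ Πℤ m β * det m A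
  det-scaleColumns zero    β A = refl
  det-scaleColumns (suc m) β A =
    trans (Σℤ-cong (suc m) (λ i _ → trans (cong (λ d → sign i * (β 0 * A i 0 * d)) (det-scaleColumns m (β ∘ suc) (minor A i)))
                                          (regroup (sign i) (β 0) (A i 0) (Πℤ m (β ∘ suc)) (det m (minor A i)))))
          (Σℤ-*ˡ (suc m) (Πℤ (suc m) β) (λ i → sign i * (A i 0 * det m (minor A i))))
    where
    regroup : ∀ s b a P d → s * (b * a * (P * d)) ≡ (b * P) * (s * (a * d))
    regroup = solve-∀

  Πℤ-punchIn : ∀ m i (α : ℕ → ℤ) → i ≤ m → α i * Πℤ m (α ∘ punchIn i) ≡ Πℤ (suc m) α
  Πℤ-punchIn m       zero    α _         = refl
  Πℤ-punchIn (suc m) (suc i) α (s≤s i≤m) =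
    trans (swap (α (suc i)) (α 0) _) (cong (α 0 *_) (Πℤ-punchIn m i (α ∘ suc) i≤m))
    where
    swap : ∀ a b x → a * (b * x) ≡ b * (a * x)
    swap = solve-∀

  det-scaleRows : ∀ m (α : ℕ → ℤ) (A : Matrix) → det m (λ p c → α p * A p c) ≡ Πℤ m α * det m A
  det-scaleRows zero    α A = refl
  det-scaleRows (suc m) α A =
    trans (Σℤ-cong (suc m) (λ i i<m+1 →
            trans (cong (λ d → sign i * (α i * A i 0 * d)) (det-scaleRows m (α ∘ punchIn i) (minor A i)))
                  (trans (regroup (sign i) (α i) (A i 0) _ _)
                         (cong (_* (sign i * (A i 0 * det m (minor A i)))) (Πℤ-punchIn m i α (ℕ.≤-pred i<m+1))))))
          (Σℤ-*ˡ (suc m) (Πℤ (suc m) α) (λ i → sign i * (A i 0 * det m (minor A i))))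
    where
    regroup : ∀ s a b P d → s * (a * b * (P * d)) ≡ (a * P) * (s * (b * d))
    regroup = solve-∀

module GelfandTsetlin where
  open import Data.Nat using (ℕ; zero; suc; z≤n; s≤s; _<_; _≤_; _∸_) renaming (_+_ to _+ℕ_)
  import Data.Nat.Properties as ℕ
  open import Data.Nat.Combinatorics using (_C_; nCk+nC[k+1]≡[n+1]C[k+1])
  open import Data.Integer using (ℤ; +_; _+_; _*_; _-_; 1ℤ)
  import Data.Integer.Properties as ℤ
  open import Data.Integer.Tactic.RingSolver using (solve-∀)
  open import Data.Product using (_×_; _,_; proj₁; proj₂)
  open import Data.Empty using (⊥-elim)
  open import Function using (_∘_)
  open import Relation.Binary.PropositionalEquality
  open import Algebra.Properties.CommutativeSemigroup ℕ.+-commutativeSemigroup using (xy∙z≈xz∙y)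
  open Determinants

  Σℕ : ℕ → (ℕ → ℕ) → ℕ
  Σℕ zero    f = 0
  Σℕ (suc m) f = f 0 +ℕ Σℕ m (f ∘ suc)

  Σℕ-cong : ∀ m {f g : ℕ → ℕ} → (∀ i → i < m → f i ≡ g i) → Σℕ m f ≡ Σℕ m g
  Σℕ-cong zero    f≡g = refl
  Σℕ-cong (suc m) f≡g = cong₂ _+ℕ_ (f≡g 0 (s≤s z≤n)) (Σℕ-cong m (λ i i<m → f≡g (suc i) (s≤s i<m)))

  +-Σℕ : ∀ m (f : ℕ → ℕ) → + Σℕ m f ≡ Σℤ m (λ i → + f i)
  +-Σℕ zero    f = refl
  +-Σℕ (suc m) f = trans (ℤ.pos-+ (f 0) _) (cong (λ x → + f 0 + x) (+-Σℕ m (f ∘ suc)))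

  rangeSum : ℕ → ℕ → (ℕ → ℕ) → ℕ
  rangeSum lo hi f = Σℕ (suc hi ∸ lo) (λ d → f (lo +ℕ d))

  rangeSumℤ : ℕ → ℕ → (ℕ → ℤ) → ℤ
  rangeSumℤ lo hi f = Σℤ (suc hi ∸ lo) (λ d → f (lo +ℕ d))

  rangeSum-index : ∀ lo hi d → d < suc hi ∸ lo → lo +ℕ d ≤ hi
  rangeSum-index zero     hi       d (s≤s d≤hi) = d≤hi
  rangeSum-index (suc lo) zero     d d<0        = ⊥-elim (ℕ.n≮0 (subst (d <_) (ℕ.0∸n≡0 lo) d<0))
  rangeSum-index (suc lo) (suc hi) d d<len      = s≤s (rangeSum-index lo hi d d<len)

  _◂_ : {A : Set} → A → (ℕ → A) → ℕ → A
  (x ◂ xs) zero    = x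
  (x ◂ xs) (suc p) = xs p

  boxSum : ℕ → (ℕ → ℕ) → (ℕ → ℕ) → ((ℕ → ℕ) → ℕ) → ℕ
  boxSum zero    lo hi F = F (λ _ → 0)
  boxSum (suc L) lo hi F = rangeSum (lo 0) (hi 0) (λ v → boxSum L (lo ∘ suc) (hi ∘ suc) (F ∘ (v ◂_)))

  boxSumℤ : ℕ → (ℕ → ℕ) → (ℕ → ℕ) → ((ℕ → ℕ) → ℤ) → ℤ
  boxSumℤ zero    lo hi F = F (λ _ → 0)
  boxSumℤ (suc L) lo hi F = rangeSumℤ (lo 0) (hi 0) (λ v → boxSumℤ L (lo ∘ suc) (hi ∘ suc) (F ∘ (v ◂_)))

  +-boxSum : ∀ L lo hi (F : (ℕ → ℕ) → ℕ) → + boxSum L lo hi F ≡ boxSumℤ L lo hi (λ ν → + F ν)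
  +-boxSum zero    lo hi F = refl
  +-boxSum (suc L) lo hi F = trans (+-Σℕ (suc (hi 0) ∸ lo 0) _)
    (Σℤ-cong (suc (hi 0) ∸ lo 0) (λ d _ → +-boxSum L (lo ∘ suc) (hi ∘ suc) (F ∘ ((lo 0 +ℕ d) ◂_))))

  InBox : ℕ → (ℕ → ℕ) → (ℕ → ℕ) → (ℕ → ℕ) → Set
  InBox L lo hi ν = ∀ p → p < L → lo p ≤ ν p × ν p ≤ hi p

  boxSumℤ-cong : ∀ L lo hi {F G : (ℕ → ℕ) → ℤ} → (∀ ν → InBox L lo hi ν → F ν ≡ G ν) →
                 boxSumℤ L lo hi F ≡ boxSumℤ L lo hi G
  boxSumℤ-cong zero    lo hi F≡G = F≡G _ (λ p ())
  boxSumℤ-cong (suc L) lo hi F≡G = Σℤ-cong _ λ d d<len →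
    boxSumℤ-cong L (lo ∘ suc) (hi ∘ suc) λ ν ν∈box → F≡G _ (consInBox d d<len ν ν∈box)
    where
    consInBox : ∀ d → d < suc (hi 0) ∸ lo 0 → ∀ ν → InBox L (lo ∘ suc) (hi ∘ suc) ν → InBox (suc L) lo hi ((lo 0 +ℕ d) ◂ ν)
    consInBox d d<len ν ν∈box zero    _         = ℕ.m≤m+n (lo 0) d , rangeSum-index (lo 0) (hi 0) d d<len
    consInBox d d<len ν ν∈box (suc p) (s≤s p<L) = ν∈box p p<L

  boxSumℤ-*ˡ : ∀ L lo hi a (F : (ℕ → ℕ) → ℤ) → boxSumℤ L lo hi (λ ν → a * F ν) ≡ a * boxSumℤ L lo hi F
  boxSumℤ-*ˡ zero    lo hi a F = refl
  boxSumℤ-*ˡ (suc L) lo hi a F =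
    trans (Σℤ-cong (suc (hi 0) ∸ lo 0) (λ d _ → boxSumℤ-*ˡ L (lo ∘ suc) (hi ∘ suc) a (F ∘ ((lo 0 +ℕ d) ◂_))))
          (Σℤ-*ˡ (suc (hi 0) ∸ lo 0) a _)

  #GT : ℕ → (ℕ → ℕ) → ℕ
  #GT zero    β = 1
  #GT (suc L) β = boxSum (suc L) (β ∘ suc) β (#GT L)

  RowLocal : ℕ → (Matrix → ℤ) → Set
  RowLocal m Φ = ∀ A B → (∀ p c → p < m → A p c ≡ B p c) → Φ A ≡ Φ B

  RowAdditive : ℕ → (Matrix → ℤ) → Set
  RowAdditive m Φ = ∀ r → r < m → ∀ A cnt (h : ℕ → ℕ → ℤ) →
                    Φ (setRow A r (λ c → ∑[ d < cnt ] h d c)) ≡ ∑[ d < cnt ] Φ (setRow A r (h d))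

  -- Expanding one row at a time; fixing row 0 to a summand leaves a function of the remaining rows
  -- with the same two properties.
  multilinear-rangeSums : ∀ m (Φ : Matrix → ℤ) → RowLocal m Φ → RowAdditive m Φ →
                          ∀ (g : ℕ → ℕ → ℕ → ℤ) lo hi →
                          Φ (λ i c → rangeSumℤ (lo i) (hi i) (λ v → g i v c)) ≡ boxSumℤ m lo hi (λ ν → Φ (λ i → g i (ν i)))
  multilinear-rangeSums zero    Φ local additive g lo hi = local _ _ (λ p c ())
  multilinear-rangeSums (suc m) Φ local additive g lo hi = begin
    Φ S
      ≡⟨ local _ _ (λ p c _ → sym (cong (λ row → row c) (setRow-self S 0 p))) ⟩
    Φ (setRow S 0 (λ c → rangeSumℤ (lo 0) (hi 0) (λ v → g 0 v c)))
      ≡⟨ additive 0 (s≤s z≤n) S (suc (hi 0) ∸ lo 0) (λ d → g 0 (lo 0 +ℕ d)) ⟩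
    rangeSumℤ (lo 0) (hi 0) (λ v → Φ (setRow S 0 (g 0 v)))
      ≡⟨ Σℤ-cong (suc (hi 0) ∸ lo 0) (λ d _ → expandRest (lo 0 +ℕ d)) ⟩
    boxSumℤ (suc m) lo hi (λ ν → Φ (λ i → g i (ν i))) ∎
    where
    open ≡-Reasoning
    S : Matrix
    S i c = rangeSumℤ (lo i) (hi i) (λ v → g i v c)
    Φ[_◂] : (ℕ → ℤ) → Matrix → ℤ
    Φ[ row ◂] B = Φ (row ◂ B)
    localRest : ∀ row → RowLocal m Φ[ row ◂]
    localRest row A B A≡B = local _ _ λ where
      zero    c _         → refl
      (suc p) c (s≤s p<m) → A≡B p c p<m
    additiveRest : ∀ row → RowAdditive m Φ[ row ◂]
    additiveRest row r r<m A cnt h =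
      trans (local _ _ (λ p c _ → setRow-◂ p c)) (trans (additive (suc r) (s≤s r<m) (row ◂ A) cnt h)
            (Σℤ-cong cnt (λ d _ → local _ _ (λ p c _ → sym (setRow-◂ p c)))))
      where
      setRow-◂ : ∀ {v} p c → (row ◂ setRow A r v) p c ≡ setRow (row ◂ A) (suc r) v p c
      setRow-◂ zero    c = refl
      setRow-◂ (suc p) c = refl
    expandRest : ∀ v → Φ (setRow S 0 (g 0 v)) ≡ boxSumℤ m (lo ∘ suc) (hi ∘ suc) (λ ν → Φ (λ i → g i ((v ◂ ν) i)))
    expandRest v = begin
      Φ (setRow S 0 (g 0 v))
        ≡⟨ local _ _ (λ where zero c _ → refl ; (suc p) c _ → refl) ⟩
      Φ[ g 0 v ◂] (λ i c → rangeSumℤ (lo (suc i)) (hi (suc i)) (λ w → g (suc i) w c))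
        ≡⟨ multilinear-rangeSums m Φ[ g 0 v ◂] (localRest (g 0 v)) (additiveRest (g 0 v)) (g ∘ suc) (lo ∘ suc) (hi ∘ suc) ⟩
      boxSumℤ m (lo ∘ suc) (hi ∘ suc) (λ ν → Φ[ g 0 v ◂] (λ i → g (suc i) (ν i)))
        ≡⟨ boxSumℤ-cong m (lo ∘ suc) (hi ∘ suc) (λ ν _ → local _ _ (λ where zero c _ → refl ; (suc p) c _ → refl)) ⟩
      boxSumℤ m (lo ∘ suc) (hi ∘ suc) (λ ν → Φ (λ i → g i ((v ◂ ν) i))) ∎

  hockeyStick : ∀ x c cnt → x C suc c +ℕ Σℕ cnt (λ d → (x +ℕ d) C c) ≡ (x +ℕ cnt) C suc c
  hockeyStick x c zero      = trans (ℕ.+-identityʳ _) (cong (_C suc c) (sym (ℕ.+-identityʳ x)))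
  hockeyStick x c (suc cnt) = begin
    x C suc c +ℕ ((x +ℕ 0) C c +ℕ Σℕ cnt (λ d → (x +ℕ suc d) C c))
      ≡⟨ cong (λ y → x C suc c +ℕ (y C c +ℕ Σℕ cnt (λ d → (x +ℕ suc d) C c))) (ℕ.+-identityʳ x) ⟩
    x C suc c +ℕ (x C c +ℕ Σℕ cnt (λ d → (x +ℕ suc d) C c))
      ≡⟨ ℕ.+-assoc (x C suc c) (x C c) _ ⟨
    (x C suc c +ℕ x C c) +ℕ Σℕ cnt (λ d → (x +ℕ suc d) C c)
      ≡⟨ cong₂ _+ℕ_ (trans (ℕ.+-comm (x C suc c) (x C c)) (nCk+nC[k+1]≡[n+1]C[k+1] x c))
                    (Σℕ-cong cnt (λ d _ → cong (_C c) (ℕ.+-suc x d))) ⟩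
    suc x C suc c +ℕ Σℕ cnt (λ d → (suc x +ℕ d) C c)
      ≡⟨ hockeyStick (suc x) c cnt ⟩
    (suc x +ℕ cnt) C suc c
      ≡⟨ cong (_C suc c) (ℕ.+-suc x cnt) ⟨
    (x +ℕ suc cnt) C suc c ∎
    where open ≡-Reasoning

  rangeSumℤ-binomial : ∀ s c a b → a ≤ suc b →
                       rangeSumℤ a b (λ v → + ((v +ℕ s) C c)) ≡ + ((suc b +ℕ s) C suc c) - + ((a +ℕ s) C suc c)
  rangeSumℤ-binomial s c a b a≤b+1 = begin
    rangeSumℤ a b (λ v → + ((v +ℕ s) C c))
      ≡⟨ +-Σℕ cnt (λ d → (a +ℕ d +ℕ s) C c) ⟨
    + Σℕ cnt (λ d → (a +ℕ d +ℕ s) C c)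
      ≡⟨ cong +_ (Σℕ-cong cnt (λ d _ → cong (_C c) (xy∙z≈xz∙y a d s))) ⟩
    + Σℕ cnt (λ d → (a +ℕ s +ℕ d) C c)
      ≡⟨ x+y-x≡y (+ ((a +ℕ s) C suc c)) _ ⟨
    + ((a +ℕ s) C suc c) + + Σℕ cnt (λ d → (a +ℕ s +ℕ d) C c) - + ((a +ℕ s) C suc c)
      ≡⟨ cong (_- + ((a +ℕ s) C suc c)) (trans (sym (ℤ.pos-+ ((a +ℕ s) C suc c) (Σℕ cnt (λ d → (a +ℕ s +ℕ d) C c))))
                                               (cong +_ (hockeyStick (a +ℕ s) c cnt))) ⟩
    + ((a +ℕ s +ℕ cnt) C suc c) - + ((a +ℕ s) C suc c)
      ≡⟨ cong (λ y → + (y C suc c) - + ((a +ℕ s) C suc c)) (trans (xy∙z≈xz∙y a s cnt) (cong (_+ℕ s) (ℕ.m+[n∸m]≡n a≤b+1))) ⟩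
    + ((suc b +ℕ s) C suc c) - + ((a +ℕ s) C suc c) ∎
    where
    open ≡-Reasoning
    cnt = suc b ∸ a
    x+y-x≡y : ∀ x y → x + y - x ≡ y
    x+y-x≡y = solve-∀

  Decreasing : ℕ → (ℕ → ℕ) → Set
  Decreasing L β = ∀ p → p < L → β (suc p) ≤ β p

  binomialMatrix : ℕ → (ℕ → ℕ) → Matrix
  binomialMatrix L β i j = + ((β i +ℕ (L ∸ i)) C j)

  σ : ℕ → ℤ
  σ zero    = 1ℤ
  σ (suc L) = sign (suc L) * σ L

  -- Subtracting from each row the next one turns row p into hockey-stick sums over the
  -- interval [β (p + 1), β p]; this is the Gelfand–Tsetlin branching rule.
  minor-differences-binomialMatrix : ∀ L β → Decreasing (suc L) β → ∀ p c → p < suc L →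
    minor (differences (binomialMatrix (suc L) β) (suc L)) (suc L) p c ≡ rangeSumℤ (β (suc p)) (β p) (λ v → + ((v +ℕ (L ∸ p)) C c))
  minor-differences-binomialMatrix L β β↓ p c p<L+1 = begin
    differences A (suc L) (punchIn (suc L) p) (suc c)
      ≡⟨ cong (λ q → differences A (suc L) q (suc c)) (punchIn-below (suc L) p p<L+1) ⟩
    differences A (suc L) p (suc c)
      ≡⟨ differences-below A (suc L) p p<L+1 (suc c) ⟩
    + ((β p +ℕ (suc L ∸ p)) C suc c) - A (suc p) (suc c)
      ≡⟨ cong (λ y → + (y C suc c) - A (suc p) (suc c)) (trans (cong (β p +ℕ_) (ℕ.+-∸-assoc 1 (ℕ.≤-pred p<L+1))) (ℕ.+-suc (β p) (L ∸ p))) ⟩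
    + ((suc (β p) +ℕ (L ∸ p)) C suc c) - + ((β (suc p) +ℕ (L ∸ p)) C suc c)
      ≡⟨ rangeSumℤ-binomial (L ∸ p) c (β (suc p)) (β p) (ℕ.m≤n⇒m≤1+n (β↓ p p<L+1)) ⟨
    rangeSumℤ (β (suc p)) (β p) (λ v → + ((v +ℕ (L ∸ p)) C c)) ∎
    where
    open ≡-Reasoning
    A = binomialMatrix (suc L) β

  det-binomialMatrix : ∀ L β → Decreasing L β → det (suc L) (binomialMatrix L β) ≡ σ L * + #GT L β
  det-binomialMatrix zero    β _  = refl
  det-binomialMatrix (suc L) β β↓ = begin
    det (suc (suc L)) A
      ≡⟨ det-differences (suc (suc L)) A (suc L) ℕ.≤-refl ⟨
    det (suc (suc L)) D
      ≡⟨ det-expandColumn0 (suc L) D (λ i i<L+1 → differences-below A (suc L) i i<L+1 0) ⟩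
    sign (suc L) * (D (suc L) 0 * det (suc L) (minor D (suc L)))
      ≡⟨ cong₂ (λ a d → sign (suc L) * (a * d)) (cong (λ row → row 0) (differences-above A (suc L) (suc L) ℕ.≤-refl))
               (det-cong (suc L) (λ p c → minor-differences-binomialMatrix L β β↓ p c)) ⟩
    sign (suc L) * (1ℤ * det (suc L) (λ p c → rangeSumℤ (β (suc p)) (β p) (λ v → + ((v +ℕ (L ∸ p)) C c))))
      ≡⟨ cong (λ d → sign (suc L) * (1ℤ * d)) (multilinear-rangeSums (suc L) (det (suc L)) (λ _ _ → det-cong (suc L))
               (λ r r<L+1 A → det-sumRow (suc L) r A r<L+1) (λ p v c → + ((v +ℕ (L ∸ p)) C c)) (β ∘ suc) β) ⟩
    sign (suc L) * (1ℤ * boxSumℤ (suc L) (β ∘ suc) β (λ ν → det (suc L) (binomialMatrix L ν)))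
      ≡⟨ cong (λ d → sign (suc L) * (1ℤ * d)) (boxSumℤ-cong (suc L) (β ∘ suc) β
               (λ ν ν∈box → det-binomialMatrix L ν (interlacing⇒decreasing ν ν∈box))) ⟩
    sign (suc L) * (1ℤ * boxSumℤ (suc L) (β ∘ suc) β (λ ν → σ L * + #GT L ν))
      ≡⟨ cong (λ d → sign (suc L) * (1ℤ * d)) (trans (boxSumℤ-*ˡ (suc L) (β ∘ suc) β (σ L) (λ ν → + #GT L ν))
               (cong (σ L *_) (sym (+-boxSum (suc L) (β ∘ suc) β (#GT L))))) ⟩
    sign (suc L) * (1ℤ * (σ L * + #GT (suc L) β))
      ≡⟨ regroup (sign (suc L)) (σ L) (+ #GT (suc L) β) ⟩
    σ (suc L) * + #GT (suc L) β ∎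
    where
    open ≡-Reasoning
    A = binomialMatrix (suc L) β
    D = differences A (suc L)
    interlacing⇒decreasing : ∀ ν → InBox (suc L) (β ∘ suc) β ν → Decreasing L ν
    interlacing⇒decreasing ν ν∈box p p<L =
      ℕ.≤-trans (proj₂ (ν∈box (suc p) (s≤s p<L))) (proj₁ (ν∈box p (ℕ.<-trans p<L (ℕ.n<1+n L))))
    regroup : ∀ s t x → s * (1ℤ * (t * x)) ≡ (s * t) * x
    regroup = solve-∀

  boxSum-cong : ∀ L {lo lo′ hi hi′ : ℕ → ℕ} {F F′ : (ℕ → ℕ) → ℕ} → (∀ p → p < L → lo p ≡ lo′ p) →
                (∀ p → p < L → hi p ≡ hi′ p) → (∀ ν → F ν ≡ F′ ν) → boxSum L lo hi F ≡ boxSum L lo′ hi′ F′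
  boxSum-cong zero    _ _ F≡F′ = F≡F′ _
  boxSum-cong (suc L) {lo} {lo′} {hi} {hi′} {F} lo≡ hi≡ F≡F′ =
    trans (cong₂ (λ a b → rangeSum a b (λ v → boxSum L (lo ∘ suc) (hi ∘ suc) (F ∘ (v ◂_)))) (lo≡ 0 (s≤s z≤n)) (hi≡ 0 (s≤s z≤n)))
          (Σℕ-cong (suc (hi′ 0) ∸ lo′ 0) λ d _ →
             boxSum-cong L (λ p p<L → lo≡ (suc p) (s≤s p<L)) (λ p p<L → hi≡ (suc p) (s≤s p<L)) (λ ν → F≡F′ ((lo′ 0 +ℕ d) ◂ ν)))

  #GT-cong : ∀ L {β β′ : ℕ → ℕ} → (∀ p → p ≤ L → β p ≡ β′ p) → #GT L β ≡ #GT L β′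
  #GT-cong zero    _    = refl
  #GT-cong (suc L) β≡β′ = boxSum-cong (suc L) {F = #GT L} {F′ = #GT L} (λ p p<L+1 → β≡β′ (suc p) p<L+1) (λ p p<L+1 → β≡β′ p (ℕ.<⇒≤ p<L+1)) (λ _ → refl)

module Products where
  open import Data.Nat
  open import Data.Nat.Properties
  open import Data.Nat.Tactic.RingSolver using (solve-∀)
  open import Function using (_∘_)
  open import Relation.Binary.PropositionalEquality

  Πℕ : ℕ → (ℕ → ℕ) → ℕ
  Πℕ zero    f = 1
  Πℕ (suc m) f = f 0 * Πℕ m (f ∘ suc)

  Πℕ-cong : ∀ m {f g : ℕ → ℕ} → (∀ i → i < m → f i ≡ g i) → Πℕ m f ≡ Πℕ m g
  Πℕ-cong zero    f≡g = refl
  Πℕ-cong (suc m) f≡g = cong₂ _*_ (f≡g 0 (s≤s z≤n)) (Πℕ-cong m (λ i i<m → f≡g (suc i) (s≤s i<m)))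

  Πℕ-snoc : ∀ k f → Πℕ (suc k) f ≡ Πℕ k f * f k
  Πℕ-snoc zero    f = trans (*-identityʳ (f 0)) (sym (+-identityʳ (f 0)))
  Πℕ-snoc (suc k) f = trans (cong (f 0 *_) (Πℕ-snoc k (f ∘ suc))) (sym (*-assoc (f 0) _ _))

  Πℕ-suc≡! : ∀ k → Πℕ k suc ≡ k !
  Πℕ-suc≡! zero    = refl
  Πℕ-suc≡! (suc k) = trans (Πℕ-snoc k suc) (trans (cong (_* suc k) (Πℕ-suc≡! k)) (*-comm (k !) (suc k)))

  Πℕ-* : ∀ k (f g : ℕ → ℕ) → Πℕ k (λ i → f i * g i) ≡ Πℕ k f * Πℕ k g
  Πℕ-* zero    f g = refl
  Πℕ-* (suc k) f g = trans (cong (f 0 * g 0 *_) (Πℕ-* k (f ∘ suc) (g ∘ suc))) (interchange (f 0) (g 0) _ _)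
    where
    interchange : ∀ a b x y → a * b * (x * y) ≡ a * x * (b * y)
    interchange = solve-∀

  Πℕ-*ˡ : ∀ k c (g : ℕ → ℕ) → Πℕ k (λ i → c * g i) ≡ c ^ k * Πℕ k g
  Πℕ-*ˡ zero    c g = refl
  Πℕ-*ˡ (suc k) c g = trans (cong (c * g 0 *_) (Πℕ-*ˡ k c (g ∘ suc))) (regroup c (g 0) (c ^ k) _)
    where
    regroup : ∀ c a p x → c * a * (p * x) ≡ c * p * (a * x)
    regroup = solve-∀

  Πℕ-reverse : ∀ k f → Πℕ k f ≡ Πℕ k (λ i → f (k ∸ suc i))
  Πℕ-reverse zero    f = refl
  Πℕ-reverse (suc k) f = begin
    f 0 * Πℕ k (f ∘ suc)                    ≡⟨ cong (f 0 *_) (Πℕ-reverse k (f ∘ suc)) ⟩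
    f 0 * Πℕ k (λ i → f (suc (k ∸ suc i)))  ≡⟨ *-comm (f 0) _ ⟩
    Πℕ k (λ i → f (suc (k ∸ suc i))) * f 0  ≡⟨ cong₂ _*_ (Πℕ-cong k (λ i i<k → cong f (sym (+-∸-assoc 1 i<k)))) (cong f (sym (n∸n≡0 k))) ⟩
    Πℕ k (λ i → f (k ∸ i)) * f (k ∸ k)      ≡⟨ Πℕ-snoc k (λ i → f (suc k ∸ suc i)) ⟨
    Πℕ (suc k) (λ i → f (suc k ∸ suc i))    ∎
    where open ≡-Reasoning

  Πℕ-nonZero : ∀ k f → (∀ i → i < k → NonZero (f i)) → NonZero (Πℕ k f)
  Πℕ-nonZero zero    f f≢0 = _
  Πℕ-nonZero (suc k) f f≢0 = m*n≢0 (f 0) _ {{f≢0 0 (s≤s z≤n)}} {{Πℕ-nonZero k (f ∘ suc) (λ i i<k → f≢0 (suc i) (s≤s i<k))}}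

module FallingFactorials where
  open import Data.Nat
  open import Data.Nat.Properties
  open import Data.Nat.Combinatorics using (_C_; nCk+nC[k+1]≡[n+1]C[k+1])
  open import Data.Nat.Tactic.RingSolver using (solve-∀)
  open import Data.Sum using (inj₁; inj₂)
  open Products
  open import Relation.Binary.PropositionalEquality

  superfactorial : ℕ → ℕ
  superfactorial zero    = 1
  superfactorial (suc k) = k ! * superfactorial k

  fall : ℕ → ℕ → ℕ
  fall x zero    = 1
  fall x (suc j) = x * fall (x ∸ 1) j

  fall-snoc : ∀ x j → fall x (suc j) ≡ fall x j * (x ∸ j)
  fall-snoc x zero    = trans (*-identityʳ x) (sym (+-identityʳ x))
  fall-snoc x (suc j) = begin
    x * fall (x ∸ 1) (suc j)          ≡⟨ cong (x *_) (fall-snoc (x ∸ 1) j) ⟩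
    x * (fall (x ∸ 1) j * (x ∸ 1 ∸ j)) ≡⟨ *-assoc x (fall (x ∸ 1) j) _ ⟨
    x * fall (x ∸ 1) j * (x ∸ 1 ∸ j)   ≡⟨ cong (x * fall (x ∸ 1) j *_) (∸-+-assoc x 1 j) ⟩
    x * fall (x ∸ 1) j * (x ∸ suc j)   ∎
    where open ≡-Reasoning

  fall-zero : ∀ x j → x < j → fall x j ≡ 0
  fall-zero zero    (suc j) _         = refl
  fall-zero (suc x) (suc j) (s≤s x<j) = trans (cong (suc x *_) (fall-zero x j x<j)) (*-zeroʳ (suc x))

  fall-suc : ∀ y j → fall (suc y) (suc j) ≡ fall y (suc j) + suc j * fall y j
  fall-suc y j with ≤-<-connex j y
  ... | inj₁ j≤y = begin
    suc y * fall y j                       ≡⟨ cong (_* fall y j) (trans (+-suc (y ∸ j) j) (cong suc (m∸n+n≡m j≤y))) ⟨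
    (y ∸ j + suc j) * fall y j             ≡⟨ distrib (y ∸ j) (suc j) (fall y j) ⟩
    fall y j * (y ∸ j) + suc j * fall y j  ≡⟨ cong (_+ suc j * fall y j) (fall-snoc y j) ⟨
    fall y (suc j) + suc j * fall y j      ∎
    where
    open ≡-Reasoning
    distrib : ∀ a b f → (a + b) * f ≡ f * a + b * f
    distrib = solve-∀
  ... | inj₂ y<j = begin
    suc y * fall y j                   ≡⟨ cong (suc y *_) (fall-zero y j y<j) ⟩
    suc y * 0                          ≡⟨ *-zeroʳ (suc y) ⟩
    0                                  ≡⟨ *-zeroʳ (suc j) ⟨
    suc j * 0                          ≡⟨ cong₂ (λ a b → a + suc j * b) (fall-zero y (suc j) (m<n⇒m<1+n y<j)) (fall-zero y j y<j) ⟨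
    fall y (suc j) + suc j * fall y j  ∎
    where open ≡-Reasoning

  fall-+ : ∀ x t j → fall x (t + j) ≡ fall x t * fall (x ∸ t) j
  fall-+ x zero    j = sym (+-identityʳ _)
  fall-+ x (suc t) j = begin
    x * fall (x ∸ 1) (t + j)                       ≡⟨ cong (x *_) (fall-+ (x ∸ 1) t j) ⟩
    x * (fall (x ∸ 1) t * fall (x ∸ 1 ∸ t) j)      ≡⟨ *-assoc x (fall (x ∸ 1) t) _ ⟨
    x * fall (x ∸ 1) t * fall (x ∸ 1 ∸ t) j        ≡⟨ cong (λ y → x * fall (x ∸ 1) t * fall y j) (∸-+-assoc x 1 t) ⟩
    x * fall (x ∸ 1) t * fall (x ∸ suc t) j        ∎
    where open ≡-Reasoning

  C*!≡fall : ∀ x m → (x C m) * m ! ≡ fall x m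
  C*!≡fall x       zero    = refl
  C*!≡fall zero    (suc m) = refl
  C*!≡fall (suc x) (suc m) = begin
    (suc x C suc m) * suc m !                                ≡⟨ cong (_* suc m !) (nCk+nC[k+1]≡[n+1]C[k+1] x m) ⟨
    (x C m + x C suc m) * suc m !                            ≡⟨ expand (x C m) (x C suc m) (m !) m ⟩
    (x C suc m) * suc m ! + suc m * ((x C m) * m !)          ≡⟨ cong₂ (λ a b → a + suc m * b) (C*!≡fall x (suc m)) (C*!≡fall x m) ⟩
    fall x (suc m) + suc m * fall x m                        ≡⟨ fall-suc x m ⟨
    fall (suc x) (suc m)                                     ∎
    where
    open ≡-Reasoning
    expand : ∀ a b f m → (a + b) * (f + m * f) ≡ b * (f + m * f) + suc m * (a * f)
    expand = solve-∀

  Πℕ-! : ∀ k → Πℕ k _! ≡ superfactorial k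
  Πℕ-! zero    = refl
  Πℕ-! (suc k) = trans (Πℕ-snoc k _!) (trans (cong (_* k !) (Πℕ-! k)) (*-comm (superfactorial k) (k !)))

module Evaluation where
  open import Data.Nat using (ℕ; zero; suc; z≤n; s≤s; _<_; _≤_; _∸_; _!) renaming (_+_ to _+ℕ_; _*_ to _*ℕ_)
  import Data.Nat.Properties as ℕ
  open import Data.Nat.Combinatorics using (_C_; nCn≡1; k>n⇒nCk≡0)
  open import Data.Integer using (ℤ; +_; -_; _+_; _*_; _-_; 0ℤ; 1ℤ)
  import Data.Integer.Properties as ℤ
  open import Data.Integer.Tactic.RingSolver using (solve-∀)
  open import Data.Sum using (_⊎_; inj₁; inj₂)
  open import Function using (_∘_)
  open import Level using (0ℓ)
  open import Relation.Binary.Bundles using (Preorder)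
  open import Relation.Binary.PropositionalEquality
  import Relation.Binary.Reasoning.Preorder as PreorderReasoning
  open Determinants
  open GelfandTsetlin
  open Products
  open FallingFactorials

  infix 4 _≈±_

  _≈±_ : ℤ → ℤ → Set
  a ≈± b = a ≡ b ⊎ a ≡ - b

  ≈±-trans : ∀ {a b c} → a ≈± b → b ≈± c → a ≈± c
  ≈±-trans (inj₁ refl) b≈±c        = b≈±c
  ≈±-trans (inj₂ refl) (inj₁ refl) = inj₂ refl
  ≈±-trans (inj₂ refl) (inj₂ refl) = inj₁ (ℤ.neg-involutive _)

  ≈±-preorder : Preorder 0ℓ 0ℓ 0ℓ
  ≈±-preorder = record
    { isPreorder = record
      { isEquivalence = isEquivalence
      ; reflexive     = inj₁
      ; trans         = ≈±-trans
      }
    }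

  module ≈±-Reasoning = PreorderReasoning ≈±-preorder

  ≈±-sym : ∀ {a b} → a ≈± b → b ≈± a
  ≈±-sym (inj₁ refl) = inj₁ refl
  ≈±-sym (inj₂ refl) = inj₂ (sym (ℤ.neg-involutive _))

  ≈±-neg : ∀ {a b} → a ≈± b → - a ≈± b
  ≈±-neg (inj₁ refl) = inj₂ refl
  ≈±-neg (inj₂ refl) = inj₁ (ℤ.neg-involutive _)

  ≈±-*ˡ : ∀ c {a b} → a ≈± b → c * a ≈± c * b
  ≈±-*ˡ c (inj₁ refl) = inj₁ refl
  ≈±-*ˡ c (inj₂ refl) = inj₂ (sym (ℤ.neg-distribʳ-* c _))

  sign-≈± : ∀ i a → sign i * a ≈± a
  sign-≈± zero    a = inj₁ (ℤ.*-identityˡ a)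
  sign-≈± (suc i) a = subst (_≈± a) (ℤ.neg-distribˡ-* (sign i) a) (≈±-neg (sign-≈± i a))

  σ-≈± : ∀ L a → σ L * a ≈± a
  σ-≈± zero    a = inj₁ (ℤ.*-identityˡ a)
  σ-≈± (suc L) a = subst (_≈± a) (sym (ℤ.*-assoc (sign (suc L)) (σ L) a))
                         (≈±-trans (sign-≈± (suc L) (σ L * a)) (σ-≈± L a))

  +-≈±-injective : ∀ {m n} → + m ≈± + n → m ≡ n
  +-≈±-injective (inj₁ eq) = ℤ.+-injective eq
  +-≈±-injective {m} {zero}  (inj₂ eq) = ℤ.+-injective eq
  +-≈±-injective {m} {suc n} (inj₂ ())

  Πℤ-+ : ∀ m f → Πℤ m (λ i → + f i) ≡ + Πℕ m f
  Πℤ-+ zero    f = refl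
  Πℤ-+ (suc m) f = trans (cong (+ f 0 *_) (Πℤ-+ m (f ∘ suc))) (sym (ℤ.pos-* (f 0) _))

  -- The last row is a unit row; expanding along it shifts the columns by one and leaves the same
  -- situation with one row fewer.
  det-stripRows : ∀ s k e (l : ℕ → ℕ) → (∀ i → k ≤ i → i < s +ℕ k → l i ≡ e +ℕ (s +ℕ k ∸ suc i)) →
                  det (s +ℕ k) (λ i j → + (l i C (j +ℕ e))) ≈± det k (λ i j → + (l i C (j +ℕ (e +ℕ s))))
  det-stripRows zero    k e l _   = inj₁ (det-cong k (λ i j _ → cong (λ x → + (l i C (j +ℕ x))) (sym (ℕ.+-identityʳ e))))
  det-stripRows (suc s) k e l l≡ = begin
    det (suc (s +ℕ k)) A
      ≡⟨ det-expandLastRow (s +ℕ k) A lastRow≡0 ⟩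
    sign (s +ℕ k) * (A (s +ℕ k) 0 * det (s +ℕ k) (minor A (s +ℕ k)))
      ≡⟨ cong₂ (λ a d → sign (s +ℕ k) * (a * d)) corner≡1 (det-cong (s +ℕ k) minor≡) ⟩
    sign (s +ℕ k) * (1ℤ * det (s +ℕ k) (λ i j → + (l i C (j +ℕ suc e))))
      ≲⟨ sign-≈± (s +ℕ k) _ ⟩
    1ℤ * det (s +ℕ k) (λ i j → + (l i C (j +ℕ suc e)))
      ≡⟨ ℤ.*-identityˡ _ ⟩
    det (s +ℕ k) (λ i j → + (l i C (j +ℕ suc e)))
      ≲⟨ det-stripRows s k (suc e) l l≡′ ⟩
    det k (λ i j → + (l i C (j +ℕ (suc e +ℕ s))))
      ≡⟨ det-cong k (λ i j _ → cong (λ x → + (l i C (j +ℕ x))) (sym (ℕ.+-suc e s))) ⟩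
    det k (λ i j → + (l i C (j +ℕ (e +ℕ suc s)))) ∎
    where
    open ≈±-Reasoning
    A : Matrix
    A i j = + (l i C (j +ℕ e))
    lastRow : l (s +ℕ k) ≡ e
    lastRow = trans (l≡ (s +ℕ k) (ℕ.m≤n+m k s) (ℕ.n<1+n _)) (trans (cong (e +ℕ_) (ℕ.n∸n≡0 (s +ℕ k))) (ℕ.+-identityʳ e))
    lastRow≡0 : ∀ c → A (s +ℕ k) (suc c) ≡ 0ℤ
    lastRow≡0 c = cong +_ (trans (cong (_C (suc c +ℕ e)) lastRow) (k>n⇒nCk≡0 (s≤s (ℕ.m≤n+m e c))))
    corner≡1 : A (s +ℕ k) 0 ≡ 1ℤ
    corner≡1 = cong +_ (trans (cong (_C e) lastRow) (nCn≡1 e))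
    minor≡ : ∀ p c → p < s +ℕ k → minor A (s +ℕ k) p c ≡ + (l p C (c +ℕ suc e))
    minor≡ p c p<s+k = trans (cong (λ q → A q (suc c)) (punchIn-below (s +ℕ k) p p<s+k))
                             (cong (λ x → + (l p C x)) (sym (ℕ.+-suc c e)))
    l≡′ : ∀ i → k ≤ i → i < s +ℕ k → l i ≡ suc e +ℕ (s +ℕ k ∸ suc i)
    l≡′ i k≤i i<s+k = trans (l≡ i k≤i (ℕ.m<n⇒m<1+n i<s+k)) (trans (cong (e +ℕ_) (ℕ.+-∸-assoc 1 i<s+k)) (ℕ.+-suc e _))

  fall-difference : ∀ y c → + fall (suc y) (suc c) - + fall y (suc c) ≡ + suc c * + fall y c
  fall-difference y c = begin
    + fall (suc y) (suc c) - + fall y (suc c)                ≡⟨ cong (_- + fall y (suc c)) (trans (cong +_ (fall-suc y c)) (ℤ.pos-+ (fall y (suc c)) _)) ⟩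
    + fall y (suc c) + + (suc c *ℕ fall y c) - + fall y (suc c) ≡⟨ x+y-x≡y (+ fall y (suc c)) _ ⟩
    + (suc c *ℕ fall y c)                                    ≡⟨ ℤ.pos-* (suc c) (fall y c) ⟩
    + suc c * + fall y c                                     ∎
    where
    open ≡-Reasoning
    x+y-x≡y : ∀ x y → x + y - x ≡ y
    x+y-x≡y = solve-∀

  -- Vandermonde's determinant in the basis of falling factorials: taking differences of adjacent
  -- rows lowers every degree by one and pulls out the factor j + 1 from column j.
  det-fallingVandermonde : ∀ k a → det k (λ i j → + fall (a +ℕ (k ∸ suc i)) j) ≈± + superfactorial k
  det-fallingVandermonde zero    a = inj₁ refl
  det-fallingVandermonde (suc k) a = begin
    det (suc k) A
      ≡⟨ det-differences (suc k) A k (ℕ.n<1+n k) ⟨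
    det (suc k) D
      ≡⟨ det-expandColumn0 k D (λ i i<k → differences-below A k i i<k 0) ⟩
    sign k * (D k 0 * det k (minor D k))
      ≲⟨ sign-≈± k _ ⟩
    D k 0 * det k (minor D k)
      ≡⟨ cong₂ _*_ (cong (λ row → row 0) (differences-above A k k ℕ.≤-refl)) (det-cong k minor≡) ⟩
    1ℤ * det k (λ p c → + suc c * + fall (a +ℕ (k ∸ suc p)) c)
      ≡⟨ ℤ.*-identityˡ _ ⟩
    det k (λ p c → + suc c * + fall (a +ℕ (k ∸ suc p)) c)
      ≡⟨ det-scaleColumns k (λ c → + suc c) (λ p c → + fall (a +ℕ (k ∸ suc p)) c) ⟩
    Πℤ k (λ c → + suc c) * det k (λ p c → + fall (a +ℕ (k ∸ suc p)) c)
      ≲⟨ ≈±-*ˡ (Πℤ k (λ c → + suc c)) (det-fallingVandermonde k a) ⟩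
    Πℤ k (λ c → + suc c) * + superfactorial k
      ≡⟨ cong (_* + superfactorial k) (trans (Πℤ-+ k suc) (cong +_ (Πℕ-suc≡! k))) ⟩
    + (k !) * + superfactorial k
      ≡⟨ ℤ.pos-* (k !) (superfactorial k) ⟨
    + superfactorial (suc k) ∎
    where
    open ≈±-Reasoning
    A : Matrix
    A i j = + fall (a +ℕ (k ∸ i)) j
    D = differences A k
    minor≡ : ∀ p c → p < k → minor D k p c ≡ + suc c * + fall (a +ℕ (k ∸ suc p)) c
    minor≡ p c p<k = begin-equality
      D (punchIn k p) (suc c)                             ≡⟨ cong (λ q → D q (suc c)) (punchIn-below k p p<k) ⟩
      D p (suc c)                                         ≡⟨ differences-below A k p p<k (suc c) ⟩
      + fall (a +ℕ (k ∸ p)) (suc c) - + fall y (suc c)    ≡⟨ cong (λ x → + fall x (suc c) - + fall y (suc c)) (trans (cong (a +ℕ_) (ℕ.+-∸-assoc 1 p<k)) (ℕ.+-suc a _)) ⟩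
      + fall (suc y) (suc c) - + fall y (suc c)           ≡⟨ fall-difference y c ⟩
      + suc c * + fall y c                                ∎
      where y = a +ℕ (k ∸ suc p)

  det-binomial⇒falling : ∀ k t (l : ℕ → ℕ) →
    Πℤ k (λ c → + ((c +ℕ t) !)) * det k (λ i j → + (l i C (j +ℕ t))) ≡ Πℤ k (λ i → + fall (l i) t) * det k (λ i j → + fall (l i ∸ t) j)
  det-binomial⇒falling k t l = begin
    Πℤ k (λ c → + ((c +ℕ t) !)) * det k (λ i j → + (l i C (j +ℕ t)))
      ≡⟨ det-scaleColumns k (λ c → + ((c +ℕ t) !)) (λ i j → + (l i C (j +ℕ t))) ⟨
    det k (λ i j → + ((j +ℕ t) !) * + (l i C (j +ℕ t)))
      ≡⟨ det-cong k (λ i j _ → entry (l i) j) ⟩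
    det k (λ i j → + fall (l i) t * + fall (l i ∸ t) j)
      ≡⟨ det-scaleRows k (λ i → + fall (l i) t) (λ i j → + fall (l i ∸ t) j) ⟩
    Πℤ k (λ i → + fall (l i) t) * det k (λ i j → + fall (l i ∸ t) j) ∎
    where
    open ≡-Reasoning
    entry : ∀ x j → + ((j +ℕ t) !) * + (x C (j +ℕ t)) ≡ + fall x t * + fall (x ∸ t) j
    entry x j = begin
      + ((j +ℕ t) !) * + (x C (j +ℕ t))  ≡⟨ ℤ.pos-* ((j +ℕ t) !) (x C (j +ℕ t)) ⟨
      + ((j +ℕ t) ! *ℕ (x C (j +ℕ t)))   ≡⟨ cong +_ (ℕ.*-comm ((j +ℕ t) !) _) ⟩
      + ((x C (j +ℕ t)) *ℕ (j +ℕ t) !)   ≡⟨ cong +_ (C*!≡fall x (j +ℕ t)) ⟩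
      + fall x (j +ℕ t)                  ≡⟨ cong (λ m → + fall x m) (ℕ.+-comm j t) ⟩
      + fall x (t +ℕ j)                  ≡⟨ cong +_ (fall-+ x t j) ⟩
      + (fall x t *ℕ fall (x ∸ t) j)     ≡⟨ ℤ.pos-* (fall x t) (fall (x ∸ t) j) ⟩
      + fall x t * + fall (x ∸ t) j      ∎

  rectPartition : ℕ → ℕ → ℕ → ℕ
  rectPartition n zero    i       = 0
  rectPartition n (suc k) zero    = n
  rectPartition n (suc k) (suc i) = rectPartition n k i

  rectPartition-decreasing : ∀ n k L → Decreasing L (rectPartition n k)
  rectPartition-decreasing n zero          L p       _ = z≤n
  rectPartition-decreasing n (suc zero)    L zero    _ = z≤n
  rectPartition-decreasing n (suc (suc k)) L zero    _ = ℕ.≤-refl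
  rectPartition-decreasing n (suc k)       (suc L) (suc p) (s≤s p<L) = rectPartition-decreasing n k L p p<L

  rectPartition-< : ∀ n k i → i < k → rectPartition n k i ≡ n
  rectPartition-< n (suc k) zero    _         = refl
  rectPartition-< n (suc k) (suc i) (s≤s i<k) = rectPartition-< n k i i<k

  rectPartition-≥ : ∀ n k i → k ≤ i → rectPartition n k i ≡ 0
  rectPartition-≥ n zero    i       _         = refl
  rectPartition-≥ n (suc k) (suc i) (s≤s k≤i) = rectPartition-≥ n k i k≤i

  +[s+k∸i]∸[1+s] : ∀ n s k i → i < k → n +ℕ (s +ℕ k ∸ i) ∸ suc s ≡ n +ℕ (k ∸ suc i)
  +[s+k∸i]∸[1+s] n s k i i<k = begin
    n +ℕ (s +ℕ k ∸ i) ∸ suc s          ≡⟨ cong (λ x → n +ℕ x ∸ suc s) (trans (ℕ.+-∸-assoc s (ℕ.<⇒≤ i<k))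
                                            (trans (cong (s +ℕ_) (ℕ.+-∸-assoc 1 i<k)) (ℕ.+-suc s _))) ⟩
    n +ℕ (suc s +ℕ (k ∸ suc i)) ∸ suc s ≡⟨ cong (_∸ suc s) (ℕ.+-comm n (suc s +ℕ (k ∸ suc i))) ⟩
    suc s +ℕ (k ∸ suc i) +ℕ n ∸ suc s  ≡⟨ cong (_∸ suc s) (ℕ.+-assoc (suc s) _ n) ⟩
    suc s +ℕ ((k ∸ suc i) +ℕ n) ∸ suc s ≡⟨ ℕ.m+n∸m≡n (suc s) _ ⟩
    (k ∸ suc i) +ℕ n                 ≡⟨ ℕ.+-comm _ n ⟩
    n +ℕ (k ∸ suc i)                 ∎
    where open ≡-Reasoning

  -- The top row has k entries n followed by s + 1 zeros: the rows of the zeros are stripped, and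
  -- what remains becomes a Vandermonde determinant after scaling rows and columns.
  #GT-rectPartition : ∀ s k n →
    #GT (s +ℕ k) (rectPartition n k) *ℕ Πℕ k (λ c → (c +ℕ suc s) !) ≡ Πℕ k (λ i → fall (n +ℕ (s +ℕ k ∸ i)) (suc s)) *ℕ superfactorial k
  #GT-rectPartition s k n = +-≈±-injective (begin
    + (#GT L β *ℕ Πℕ k (λ c → (c +ℕ t) !))
      ≡⟨ trans (ℤ.pos-* (#GT L β) (Πℕ k (λ c → (c +ℕ t) !)))
               (trans (cong (+ #GT L β *_) (sym (Πℤ-+ k (λ c → (c +ℕ t) !)))) (ℤ.*-comm (+ #GT L β) P)) ⟩
    P * + #GT L β
      ≲⟨ ≈±-*ˡ P (≈±-sym (σ-≈± L (+ #GT L β))) ⟩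
    P * (σ L * + #GT L β)
      ≡⟨ cong (P *_) (det-binomialMatrix L β (rectPartition-decreasing n k L)) ⟨
    P * det (t +ℕ k) (λ i j → + (l i C j))
      ≡⟨ cong (P *_) (det-cong (t +ℕ k) (λ i j _ → cong (λ x → + (l i C x)) (sym (ℕ.+-identityʳ j)))) ⟩
    P * det (t +ℕ k) (λ i j → + (l i C (j +ℕ 0)))
      ≲⟨ ≈±-*ˡ P (det-stripRows t k 0 l zeroRows) ⟩
    P * det k (λ i j → + (l i C (j +ℕ t)))
      ≡⟨ det-binomial⇒falling k t l ⟩
    Πℤ k (λ i → + fall (l i) t) * det k (λ i j → + fall (l i ∸ t) j)
      ≡⟨ cong (Πℤ k (λ i → + fall (l i) t) *_) (det-cong k (λ i j i<k → cong (λ x → + fall x j) (lowered i i<k))) ⟩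
    Πℤ k (λ i → + fall (l i) t) * det k (λ i j → + fall (n +ℕ (k ∸ suc i)) j)
      ≲⟨ ≈±-*ˡ (Πℤ k (λ i → + fall (l i) t)) (det-fallingVandermonde k n) ⟩
    Πℤ k (λ i → + fall (l i) t) * + superfactorial k
      ≡⟨ cong (_* + superfactorial k) (trans (Πℤ-+ k (λ i → fall (l i) t))
               (cong +_ (Πℕ-cong k (λ i i<k → cong (λ x → fall (x +ℕ (L ∸ i)) t) (rectPartition-< n k i i<k))))) ⟩
    + Πℕ k (λ i → fall (n +ℕ (L ∸ i)) t) * + superfactorial k
      ≡⟨ ℤ.pos-* (Πℕ k (λ i → fall (n +ℕ (L ∸ i)) t)) (superfactorial k) ⟨
    + (Πℕ k (λ i → fall (n +ℕ (L ∸ i)) t) *ℕ superfactorial k) ∎)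
    where
    open ≈±-Reasoning
    L = s +ℕ k
    t = suc s
    β = rectPartition n k
    l : ℕ → ℕ
    l i = β i +ℕ (L ∸ i)
    P = Πℤ k (λ c → + ((c +ℕ t) !))
    zeroRows : ∀ i → k ≤ i → i < t +ℕ k → l i ≡ 0 +ℕ (t +ℕ k ∸ suc i)
    zeroRows i k≤i _ = cong (_+ℕ (L ∸ i)) (rectPartition-≥ n k i k≤i)
    lowered : ∀ i → i < k → l i ∸ t ≡ n +ℕ (k ∸ suc i)
    lowered i i<k = trans (cong (λ x → x +ℕ (s +ℕ k ∸ i) ∸ t) (rectPartition-< n k i i<k)) (+[s+k∸i]∸[1+s] n s k i i<k)

module ProductFormula where
  open import Data.Nat
  open import Data.Nat.Properties
  open import Data.Nat.Combinatorics using (_C_; nCk≡nC[n∸k])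
  open import Data.Nat.Tactic.RingSolver using (solve-∀)
  open import Relation.Binary.PropositionalEquality
  open GelfandTsetlin using (#GT)
  open Products
  open FallingFactorials
  open Evaluation using (rectPartition; #GT-rectPartition)

  Πℕ-fall-^ : ∀ a t k → Πℕ k (λ p → fall (a + p) t * (a + p) ^ p) ≡ Πℕ k (λ j → fall (a + k ∸ 1) (t + j))
  Πℕ-fall-^ a t zero    = refl
  Πℕ-fall-^ a t (suc k) = begin
    Πℕ (suc k) (λ p → fall (a + p) t * (a + p) ^ p)
      ≡⟨ Πℕ-snoc k _ ⟩
    Πℕ k (λ p → fall (a + p) t * (a + p) ^ p) * (fall (a + k) t * (a + k) ^ k)
      ≡⟨ cong (_* (fall (a + k) t * (a + k) ^ k)) (Πℕ-fall-^ a t k) ⟩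
    Πℕ k (λ j → fall (a + k ∸ 1) (t + j)) * (fall (a + k) t * (a + k) ^ k)
      ≡⟨ regroup (Πℕ k (λ j → fall (a + k ∸ 1) (t + j))) (fall (a + k) t) ((a + k) ^ k) ⟩
    fall (a + k) t * ((a + k) ^ k * Πℕ k (λ j → fall (a + k ∸ 1) (t + j)))
      ≡⟨ cong₂ _*_ (cong (fall (a + k)) (+-identityʳ t)) (Πℕ-*ˡ k (a + k) (λ j → fall (a + k ∸ 1) (t + j))) ⟨
    fall (a + k) (t + 0) * Πℕ k (λ j → (a + k) * fall (a + k ∸ 1) (t + j))
      ≡⟨ cong (fall (a + k) (t + 0) *_) (Πℕ-cong k (λ j _ → cong (fall (a + k)) (+-suc t j))) ⟨
    fall (a + k) (t + 0) * Πℕ k (λ j → fall (a + k) (t + suc j))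
      ≡⟨ cong (λ x → fall x (t + 0) * Πℕ k (λ j → fall x (t + suc j))) (cong (_∸ 1) (+-suc a k)) ⟨
    Πℕ (suc k) (λ j → fall (a + suc k ∸ 1) (t + j)) ∎
    where
    open ≡-Reasoning
    regroup : ∀ P f w → P * (f * w) ≡ f * (w * P)
    regroup = solve-∀

  private
    s+k∸[k∸q]≡s+q : ∀ s k q → q ≤ k → s + k ∸ (k ∸ q) ≡ s + q
    s+k∸[k∸q]≡s+q s k q q≤k = trans (+-∸-assoc s (m∸n≤m k q)) (cong (s +_) (m∸[m∸n]≡n q≤k))

    k∸[1+[k∸[1+p]]]≡p : ∀ k p → p < k → k ∸ suc (k ∸ suc p) ≡ p
    k∸[1+[k∸[1+p]]]≡p (suc k) p (s≤s p≤k) = m∸[m∸n]≡n p≤k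

  fall-^-product : ∀ s k n →
    Πℕ k (λ i → fall (n + (s + k ∸ i)) (suc s)) * Πℕ k (λ i → (n + (s + k ∸ i)) ^ (k ∸ suc i)) ≡ Πℕ k (λ j → fall (n + (s + k)) (suc s + j))
  fall-^-product s k n = begin
    Πℕ k (λ i → fall (x i) (suc s)) * Πℕ k (λ i → x i ^ (k ∸ suc i))
      ≡⟨ Πℕ-* k _ _ ⟨
    Πℕ k (λ i → fall (x i) (suc s) * x i ^ (k ∸ suc i))
      ≡⟨ Πℕ-reverse k _ ⟩
    Πℕ k (λ p → fall (x (k ∸ suc p)) (suc s) * x (k ∸ suc p) ^ (k ∸ suc (k ∸ suc p)))
      ≡⟨ Πℕ-cong k (λ p p<k → cong₂ (λ y e → fall y (suc s) * y ^ e) (reindexed p p<k) (k∸[1+[k∸[1+p]]]≡p k p p<k)) ⟩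
    Πℕ k (λ p → fall (n + suc s + p) (suc s) * (n + suc s + p) ^ p)
      ≡⟨ Πℕ-fall-^ (n + suc s) (suc s) k ⟩
    Πℕ k (λ j → fall (n + suc s + k ∸ 1) (suc s + j))
      ≡⟨ Πℕ-cong k (λ j _ → cong (λ y → fall y (suc s + j)) (cong (_∸ 1) (trans (cong (_+ k) (+-suc n s)) (cong suc (+-assoc n s k))))) ⟩
    Πℕ k (λ j → fall (n + (s + k)) (suc s + j)) ∎
    where
    open ≡-Reasoning
    x : ℕ → ℕ
    x i = n + (s + k ∸ i)
    reindexed : ∀ p → p < k → x (k ∸ suc p) ≡ n + suc s + p
    reindexed p p<k = trans (cong (n +_) (trans (s+k∸[k∸q]≡s+q s k (suc p) p<k) (+-suc s p))) (sym (+-assoc n (suc s) p))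

  !-binomial-product : ∀ s k n →
    Πℕ k (λ c → (c + suc s) !) * Πℕ k (λ i → (n + (s + k)) C (n + i)) ≡ Πℕ k (λ j → fall (n + (s + k)) (suc s + j))
  !-binomial-product s k n = begin
    Πℕ k (λ c → (c + suc s) !) * Πℕ k (λ i → N C (n + i))
      ≡⟨ cong (Πℕ k (λ c → (c + suc s) !) *_) (Πℕ-reverse k _) ⟩
    Πℕ k (λ c → (c + suc s) !) * Πℕ k (λ j → N C (n + (k ∸ suc j)))
      ≡⟨ Πℕ-* k _ _ ⟨
    Πℕ k (λ j → (j + suc s) ! * (N C (n + (k ∸ suc j))))
      ≡⟨ Πℕ-cong k factor ⟩
    Πℕ k (λ j → fall N (suc s + j)) ∎
    where
    open ≡-Reasoning
    N = n + (s + k)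
    symmetric : ∀ j → j < k → N C (n + (k ∸ suc j)) ≡ N C (suc s + j)
    symmetric j j<k = begin
      N C (n + (k ∸ suc j))        ≡⟨ nCk≡nC[n∸k] (+-monoʳ-≤ n (≤-trans (m∸n≤m k (suc j)) (m≤n+m k s))) ⟩
      N C (N ∸ (n + (k ∸ suc j)))  ≡⟨ cong (N C_) (trans ([m+n]∸[m+o]≡n∸o n (s + k) (k ∸ suc j)) (s+k∸[k∸q]≡s+q s k (suc j) j<k)) ⟩
      N C (s + suc j)              ≡⟨ cong (N C_) (+-suc s j) ⟩
      N C (suc s + j)              ∎
    factor : ∀ j → j < k → (j + suc s) ! * (N C (n + (k ∸ suc j))) ≡ fall N (suc s + j)
    factor j j<k = begin
      (j + suc s) ! * (N C (n + (k ∸ suc j)))  ≡⟨ cong₂ (λ m c → m ! * c) (+-comm j (suc s)) (symmetric j j<k) ⟩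
      (suc s + j) ! * (N C (suc s + j))        ≡⟨ *-comm ((suc s + j) !) _ ⟩
      (N C (suc s + j)) * (suc s + j) !        ≡⟨ C*!≡fall N (suc s + j) ⟩
      fall N (suc s + j)                       ∎

  -- Both sides, multiplied by ∏ (c + s + 1)!, become ∏_j fall (n + s + k) (s + 1 + j) · superfactorial k.
  #GT-rectPartition-product : ∀ s k n →
    #GT (s + k) (rectPartition n k) * Πℕ k (λ i → (n + (s + k ∸ i)) ^ (k ∸ suc i)) ≡ Πℕ k (λ i → ((n + (s + k)) C (n + i)) * i !)
  #GT-rectPartition-product s k n = *-cancelʳ-≡ _ _ A {{Πℕ-nonZero k (λ c → (c + suc s) !) (λ c _ → (c + suc s) !≢0)}} (begin
    G * Pw * A                 ≡⟨ swap G Pw A ⟩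
    G * A * Pw                 ≡⟨ cong (_* Pw) (#GT-rectPartition s k n) ⟩
    B * superfactorial k * Pw  ≡⟨ swap B (superfactorial k) Pw ⟩
    B * Pw * superfactorial k  ≡⟨ cong (_* superfactorial k) (trans (fall-^-product s k n) (sym (!-binomial-product s k n))) ⟩
    A * Cs * superfactorial k  ≡⟨ rotate A Cs (superfactorial k) ⟩
    Cs * superfactorial k * A  ≡⟨ cong (λ f → Cs * f * A) (Πℕ-! k) ⟨
    Cs * Πℕ k _! * A           ≡⟨ cong (_* A) (Πℕ-* k (λ i → (n + (s + k)) C (n + i)) _!) ⟨
    Πℕ k (λ i → ((n + (s + k)) C (n + i)) * i !) * A ∎)
    where
    open ≡-Reasoning
    G  = #GT (s + k) (rectPartition n k)
    A  = Πℕ k (λ c → (c + suc s) !)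
    B  = Πℕ k (λ i → fall (n + (s + k ∸ i)) (suc s))
    Pw = Πℕ k (λ i → (n + (s + k ∸ i)) ^ (k ∸ suc i))
    Cs = Πℕ k (λ i → (n + (s + k)) C (n + i))
    swap : ∀ a b c → a * b * c ≡ a * c * b
    swap = solve-∀
    rotate : ∀ a c f → a * c * f ≡ c * f * a
    rotate = solve-∀

module Grids where
  open import Data.Nat
  import Data.Nat.Properties as ℕ
  open import Data.Nat.Tactic.RingSolver using (solve-∀)
  open import Data.Bool using (true; false; if_then_else_)
  open import Data.List using (List; []; _∷_; _++_)
  open import Data.List.Membership.Propositional using (_∈_)
  open import Data.List.Relation.Unary.Any using (here; there)
  open import Data.List.Relation.Binary.Permutation.Propositional using (_↭_; refl; prep; swap; trans)
  open import Data.Product using (_×_)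
  open import Data.Product.Properties using (≡-dec)
  open import Data.Empty using (⊥-elim)
  open import Function using (_∘_)
  open import Relation.Binary.Definitions using (DecidableEquality)
  open import Relation.Binary.PropositionalEquality hiding (trans)
  import Relation.Binary.PropositionalEquality as ≡
  open import Relation.Nullary using (does; yes; no)
  open import Relation.Nullary.Decidable using (dec-true; dec-false)
  open GelfandTsetlin using (Σℕ; Σℕ-cong)

  Σℕ-zero : ∀ m {f : ℕ → ℕ} → (∀ i → i < m → f i ≡ 0) → Σℕ m f ≡ 0
  Σℕ-zero zero    f≡0 = refl
  Σℕ-zero (suc m) f≡0 = cong₂ _+_ (f≡0 0 (s≤s z≤n)) (Σℕ-zero m (λ i i<m → f≡0 (suc i) (s≤s i<m)))

  Σℕ-+ : ∀ m (f g : ℕ → ℕ) → Σℕ m (λ i → f i + g i) ≡ Σℕ m f + Σℕ m g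
  Σℕ-+ zero    f g = refl
  Σℕ-+ (suc m) f g = ≡.trans (cong (f 0 + g 0 +_) (Σℕ-+ m (f ∘ suc) (g ∘ suc))) (interchange (f 0) (g 0) _ _)
    where
    interchange : ∀ a b c d → a + b + (c + d) ≡ a + c + (b + d)
    interchange = solve-∀

  Σℕ-*ˡ : ∀ m c (f : ℕ → ℕ) → Σℕ m (λ i → c * f i) ≡ c * Σℕ m f
  Σℕ-*ˡ zero    c f = sym (ℕ.*-zeroʳ c)
  Σℕ-*ˡ (suc m) c f = ≡.trans (cong (c * f 0 +_) (Σℕ-*ˡ m c (f ∘ suc))) (sym (ℕ.*-distribˡ-+ c (f 0) _))

  Σℕ-comm : ∀ a b (f : ℕ → ℕ → ℕ) → Σℕ a (λ v → Σℕ b (f v)) ≡ Σℕ b (λ w → Σℕ a (λ v → f v w))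
  Σℕ-comm zero    b f = sym (Σℕ-zero b (λ _ _ → refl))
  Σℕ-comm (suc a) b f = ≡.trans (cong (Σℕ b (f 0) +_) (Σℕ-comm a b (f ∘ suc))) (sym (Σℕ-+ b (f 0) _))

  Σℕ-++ : ∀ a b (f : ℕ → ℕ) → Σℕ (a + b) f ≡ Σℕ a f + Σℕ b (λ d → f (a + d))
  Σℕ-++ zero    b f = refl
  Σℕ-++ (suc a) b f = ≡.trans (cong (f 0 +_) (Σℕ-++ a b (f ∘ suc))) (sym (ℕ.+-assoc (f 0) _ _))

  Cell : Set
  Cell = ℕ × ℕ

  _≟ᶜ_ : DecidableEquality Cell
  _≟ᶜ_ = ≡-dec ℕ._≟_ ℕ._≟_

  Grid : Set
  Grid = Cell → ℕ

  _[_≔_] : Grid → Cell → ℕ → Grid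
  (z [ c ≔ v ]) c′ = if does (c′ ≟ᶜ c) then v else z c′

  update-same : ∀ z c v → (z [ c ≔ v ]) c ≡ v
  update-same z c v rewrite dec-true (c ≟ᶜ c) refl = refl

  update-other : ∀ z c v c′ → c′ ≢ c → (z [ c ≔ v ]) c′ ≡ z c′
  update-other z c v c′ c′≢c rewrite dec-false (c′ ≟ᶜ c) c′≢c = refl

  update-≗ : ∀ {z z′} c v → z ≗ z′ → z [ c ≔ v ] ≗ z′ [ c ≔ v ]
  update-≗ c v z≗z′ c′ with does (c′ ≟ᶜ c)
  ... | true  = refl
  ... | false = z≗z′ c′

  update-comm : ∀ z a b v w → a ≢ b → z [ a ≔ v ] [ b ≔ w ] ≗ z [ b ≔ w ] [ a ≔ v ]
  update-comm z a b v w a≢b c with c ≟ᶜ a | c ≟ᶜ b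
  ... | yes refl | yes refl = ⊥-elim (a≢b refl)
  ... | yes _    | no  _    = refl
  ... | no  _    | yes _    = refl
  ... | no  _    | no  _    = refl

  Extensional : (Grid → ℕ) → Set
  Extensional F = ∀ {z z′} → z ≗ z′ → F z ≡ F z′

  module _ (n : ℕ) where

    Σcells : List Cell → Grid → (Grid → ℕ) → ℕ
    Σcells []       z F = F z
    Σcells (c ∷ cs) z F = Σℕ (suc n) (λ v → Σcells cs (z [ c ≔ v ]) F)

    Σcells-≗ : ∀ cs {F} → Extensional F → Extensional (λ z → Σcells cs z F)
    Σcells-≗ []       F-ext z≗z′ = F-ext z≗z′
    Σcells-≗ (c ∷ cs) F-ext z≗z′ = Σℕ-cong (suc n) (λ v _ → Σcells-≗ cs F-ext (update-≗ c v z≗z′))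

    Σcells-cong : ∀ cs {F G} → (∀ z → F z ≡ G z) → ∀ z → Σcells cs z F ≡ Σcells cs z G
    Σcells-cong []       F≡G z = F≡G z
    Σcells-cong (c ∷ cs) F≡G z = Σℕ-cong (suc n) (λ v _ → Σcells-cong cs F≡G (z [ c ≔ v ]))

    Σcells-++ : ∀ cs ds F z → Σcells (cs ++ ds) z F ≡ Σcells cs z (λ z′ → Σcells ds z′ F)
    Σcells-++ []       ds F z = refl
    Σcells-++ (c ∷ cs) ds F z = Σℕ-cong (suc n) (λ v _ → Σcells-++ cs ds F (z [ c ≔ v ]))

    Σcells-swap : ∀ a b cs {F} → Extensional F → ∀ z → Σcells (a ∷ b ∷ cs) z F ≡ Σcells (b ∷ a ∷ cs) z F
    Σcells-swap a b cs {F} F-ext z with a ≟ᶜ b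
    ... | yes refl = refl
    ... | no  a≢b  = ≡.trans (Σℕ-comm (suc n) (suc n) (λ v w → Σcells cs (z [ a ≔ v ] [ b ≔ w ]) F))
                       (Σℕ-cong (suc n) λ w _ → Σℕ-cong (suc n) λ v _ → Σcells-≗ cs F-ext (update-comm z a b v w a≢b))

    Σcells-↭ : ∀ {cs ds} → cs ↭ ds → ∀ {F} → Extensional F → ∀ z → Σcells cs z F ≡ Σcells ds z F
    Σcells-↭ refl         F-ext z = refl
    Σcells-↭ (prep c p)   F-ext z = Σℕ-cong (suc n) (λ v _ → Σcells-↭ p F-ext (z [ c ≔ v ]))
    Σcells-↭ {a ∷ b ∷ cs} (swap a b p) F-ext z = ≡.trans (Σcells-swap a b cs F-ext z)
      (Σℕ-cong (suc n) λ v _ → Σℕ-cong (suc n) λ w _ → Σcells-↭ p F-ext (z [ b ≔ v ] [ a ≔ w ]))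
    Σcells-↭ (trans p q)  F-ext z = ≡.trans (Σcells-↭ p F-ext z) (Σcells-↭ q F-ext z)

    Σcells-*ˡ : ∀ cs (a G : Grid → ℕ) → (∀ c → c ∈ cs → ∀ z v → a (z [ c ≔ v ]) ≡ a z) →
                ∀ z → Σcells cs z (λ z′ → a z′ * G z′) ≡ a z * Σcells cs z G
    Σcells-*ˡ []       a G _      z = refl
    Σcells-*ˡ (c ∷ cs) a G a-stable z = ≡.trans
      (Σℕ-cong (suc n) λ v _ → ≡.trans (Σcells-*ˡ cs a G (λ c′ c′∈cs → a-stable c′ (there c′∈cs)) (z [ c ≔ v ]))
                                        (cong (_* Σcells cs (z [ c ≔ v ]) G) (a-stable c (here refl) z v)))
      (Σℕ-*ˡ (suc n) (a z) (λ v → Σcells cs (z [ c ≔ v ]) G))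

    Σcells-cong-on : ∀ cs (P : Grid → Set) → (∀ c → c ∈ cs → ∀ z v → v ≤ n → P z → P (z [ c ≔ v ])) →
                     ∀ {F G} → (∀ z → P z → F z ≡ G z) → ∀ z → P z → Σcells cs z F ≡ Σcells cs z G
    Σcells-cong-on []       P _      F≡G z Pz = F≡G z Pz
    Σcells-cong-on (c ∷ cs) P P-pres F≡G z Pz = Σℕ-cong (suc n) λ v v<n+1 →
      Σcells-cong-on cs P (λ c′ c′∈cs → P-pres c′ (there c′∈cs)) F≡G (z [ c ≔ v ]) (P-pres c (here refl) z v (ℕ.≤-pred v<n+1) Pz)

module Diagonals (k t : ℕ) where
  open import Data.Nat

  import Data.Nat.Properties as ℕ
  open import Data.List using (List; []; _∷_; _++_; applyUpTo; upTo; cartesianProduct)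
  open import Data.List.Relation.Unary.Any using (here; there)
  open import Data.List.Membership.Propositional using (_∈_)
  open import Data.List.Membership.Propositional.Properties
    using (∈-++⁺ˡ; ∈-++⁺ʳ; ∈-++⁻; ∈-cartesianProduct⁺; ∈-cartesianProduct⁻; ∈-applyUpTo⁺; ∈-applyUpTo⁻; ∈-upTo⁺; ∈-upTo⁻)
  open import Data.List.Membership.Propositional.Properties.WithK using (unique∧set⇒bag)
  open import Data.List.Relation.Unary.Unique.Propositional using (Unique; []; _∷_)
  open import Data.List.Relation.Unary.Unique.Propositional.Properties using (++⁺; cartesianProduct⁺; applyUpTo⁺₁; upTo⁺)
  open import Data.List.Relation.Unary.All using (tabulate)
  open import Data.List.Relation.Binary.Permutation.Propositional using (_↭_)
  open import Data.List.Relation.Binary.BagAndSetEquality using (∼bag⇒↭)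
  open import Data.Empty using (⊥-elim)
  open import Data.Product using (_×_; _,_; proj₁; proj₂; ∃-syntax)
  open import Data.Sum using (inj₁; inj₂)
  open import Function using (_∘_)
  open import Function.Bundles using (mk⇔)
  open import Relation.Binary.PropositionalEquality
  open import Relation.Nullary using (¬_; Dec; yes; no)
  open import Relation.Nullary.Decidable using (_×-dec_)
  open Grids using (Cell)

  -- Level s of the grid is the diagonal of cells (I , p) with I + k = p + s + 1; its cell in column p is
  -- levelCell s p, where the truncated subtraction sends the columns p + s < k to the padding row 0.
  levelCell : ℕ → ℕ → Cell
  levelCell s p = (suc (p + s) ∸ k , p)

  Inside : ℕ → ℕ → Set
  Inside s p = k ∸ s ≤ p × p < k

  inside? : ∀ s p → Dec (Inside s p)
  inside? s p = (k ∸ s ℕ.≤? p) ×-dec (p ℕ.<? k)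

  levelCells : ℕ → ℕ → ℕ → List Cell
  levelCells s p zero    = []
  levelCells s p (suc r) with inside? s p
  ... | yes _ = levelCell s p ∷ levelCells s (suc p) r
  ... | no  _ = levelCells s (suc p) r

  levels : ℕ → ℕ → List Cell
  levels s zero    = []
  levels s (suc r) = levelCells s 0 (t + k ∸ s) ++ levels (suc s) r

  matrixCells : List Cell
  matrixCells = cartesianProduct (applyUpTo suc t) (upTo k)

  Inside⇒k≤p+s : ∀ {s p} → Inside s p → k ≤ p + s
  Inside⇒k≤p+s {s} {p} (k∸s≤p , _) =
    ℕ.≤-trans (ℕ.m≤n+m∸n k s) (subst (s + (k ∸ s) ≤_) (ℕ.+-comm s p) (ℕ.+-monoʳ-≤ s k∸s≤p))

  levelCell-row : ∀ {s p} → Inside s p → proj₁ (levelCell s p) + k ≡ suc (p + s)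
  levelCell-row inside = ℕ.m∸n+n≡m (ℕ.m≤n⇒m≤1+n (Inside⇒k≤p+s inside))

  levelCell-row≥1 : ∀ {s p} → Inside s p → 1 ≤ proj₁ (levelCell s p)
  levelCell-row≥1 inside = ℕ.m+n≤o⇒m≤o∸n 1 (s≤s (Inside⇒k≤p+s inside))

  ∈-levelCells⁻ : ∀ s p₀ r {c} → c ∈ levelCells s p₀ r → ∃[ p ] (p₀ ≤ p × p < p₀ + r × Inside s p × c ≡ levelCell s p)
  ∈-levelCells⁻ s p₀ (suc r) c∈ with inside? s p₀
  ∈-levelCells⁻ s p₀ (suc r) (here refl) | yes inside = p₀ , ℕ.≤-refl , ℕ.m<m+n p₀ (s≤s z≤n) , inside , refl
  ∈-levelCells⁻ s p₀ (suc r) (there c∈)  | yes _ with ∈-levelCells⁻ s (suc p₀) r c∈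
  ... | p , p₀<p , p<p₀+r , rest = p , ℕ.<⇒≤ p₀<p , subst (p <_) (sym (ℕ.+-suc p₀ r)) p<p₀+r , rest
  ∈-levelCells⁻ s p₀ (suc r) c∈          | no _ with ∈-levelCells⁻ s (suc p₀) r c∈
  ... | p , p₀<p , p<p₀+r , rest = p , ℕ.<⇒≤ p₀<p , subst (p <_) (sym (ℕ.+-suc p₀ r)) p<p₀+r , rest

  ∈-levelCells⁺ : ∀ s p₀ r {p} → p₀ ≤ p → p < p₀ + r → Inside s p → levelCell s p ∈ levelCells s p₀ r
  ∈-levelCells⁺ s p₀ zero    {p} p₀≤p p<p₀ _ = ⊥-elim (ℕ.<-irrefl refl (ℕ.≤-trans p<p₀ (subst (_≤ p) (sym (ℕ.+-identityʳ p₀)) p₀≤p)))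
  ∈-levelCells⁺ s p₀ (suc r) {p} p₀≤p p<p₀+r inside with inside? s p₀ | p ℕ.≟ p₀
  ... | yes _       | yes refl = here refl
  ... | no  outside | yes refl = ⊥-elim (outside inside)
  ... | yes _       | no  p≢p₀ = there (∈-levelCells⁺ s (suc p₀) r (ℕ.≤∧≢⇒< p₀≤p (p≢p₀ ∘ sym)) (subst (p <_) (ℕ.+-suc p₀ r) p<p₀+r) inside)
  ... | no  _       | no  p≢p₀ = ∈-levelCells⁺ s (suc p₀) r (ℕ.≤∧≢⇒< p₀≤p (p≢p₀ ∘ sym)) (subst (p <_) (ℕ.+-suc p₀ r) p<p₀+r) inside

  ∈-levels⁻ : ∀ s r {c} → c ∈ levels s r → ∃[ s′ ] (s ≤ s′ × s′ < s + r × c ∈ levelCells s′ 0 (t + k ∸ s′))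
  ∈-levels⁻ s (suc r) c∈ with ∈-++⁻ (levelCells s 0 (t + k ∸ s)) c∈
  ... | inj₁ c∈level = s , ℕ.≤-refl , ℕ.m<m+n s (s≤s z≤n) , c∈level
  ... | inj₂ c∈rest with ∈-levels⁻ (suc s) r c∈rest
  ...   | s′ , s<s′ , s′<s+r , c∈level = s′ , ℕ.<⇒≤ s<s′ , subst (s′ <_) (sym (ℕ.+-suc s r)) s′<s+r , c∈level

  ∈-levels⁺ : ∀ s r {s′ c} → s ≤ s′ → s′ < s + r → c ∈ levelCells s′ 0 (t + k ∸ s′) → c ∈ levels s r
  ∈-levels⁺ s zero    {s′} s≤s′ s′<s _ = ⊥-elim (ℕ.<-irrefl refl (ℕ.≤-trans s′<s (subst (_≤ s′) (sym (ℕ.+-identityʳ s)) s≤s′)))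
  ∈-levels⁺ s (suc r) {s′} s≤s′ s′<s+r c∈ with s′ ℕ.≟ s
  ... | yes refl = ∈-++⁺ˡ c∈
  ... | no  s′≢s = ∈-++⁺ʳ (levelCells s 0 (t + k ∸ s))
                     (∈-levels⁺ (suc s) r (ℕ.≤∧≢⇒< s≤s′ (s′≢s ∘ sym)) (subst (s′ <_) (ℕ.+-suc s r) s′<s+r) c∈)

  ∈-matrixCells⁻ : ∀ {I j} → (I , j) ∈ matrixCells → 1 ≤ I × I ≤ t × j < k
  ∈-matrixCells⁻ I,j∈ with I∈ , j∈ ← ∈-cartesianProduct⁻ (applyUpTo suc t) (upTo k) I,j∈
                      with i , i<t , refl ← ∈-applyUpTo⁻ suc I∈ = s≤s z≤n , i<t , ∈-upTo⁻ j∈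

  ∈-matrixCells⁺ : ∀ {I j} → 1 ≤ I → I ≤ t → j < k → (I , j) ∈ matrixCells
  ∈-matrixCells⁺ {suc i} _ i<t j<k = ∈-cartesianProduct⁺ (∈-applyUpTo⁺ suc i<t) (∈-upTo⁺ j<k)

  levelCells-unique : ∀ s p₀ r → Unique (levelCells s p₀ r)
  levelCells-unique s p₀ zero    = []
  levelCells-unique s p₀ (suc r) with inside? s p₀
  ... | yes _ = tabulate (λ c∈ eq → later c∈ eq) ∷ levelCells-unique s (suc p₀) r
    where
    later : ∀ {c} → c ∈ levelCells s (suc p₀) r → levelCell s p₀ ≢ c
    later c∈ refl with p , p₀<p , _ , _ , eq ← ∈-levelCells⁻ s (suc p₀) r c∈ = ℕ.<-irrefl (cong proj₂ eq) p₀<p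
  ... | no  _ = levelCells-unique s (suc p₀) r

  -- The level of a cell is determined by its row and column.
  levels-unique : ∀ s r → Unique (levels s r)
  levels-unique s zero    = []
  levels-unique s (suc r) = ++⁺ (levelCells-unique s 0 (t + k ∸ s)) (levels-unique (suc s) r) disjoint
    where
    disjoint : ∀ {c} → ¬ (c ∈ levelCells s 0 (t + k ∸ s) × c ∈ levels (suc s) r)
    disjoint (c∈s , c∈rest)
      with p , _ , _ , inside , refl ← ∈-levelCells⁻ s 0 (t + k ∸ s) c∈s
         | s′ , s<s′ , _ , c∈s′ ← ∈-levels⁻ (suc s) r c∈rest
      with p′ , _ , _ , inside′ , eq ← ∈-levelCells⁻ s′ 0 (t + k ∸ s′) c∈s′ =
      ℕ.<-irrefl (ℕ.+-cancelˡ-≡ p s s′ (ℕ.suc-injective (begin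
        suc (p + s)                     ≡⟨ levelCell-row inside ⟨
        proj₁ (levelCell s p) + k       ≡⟨ cong (λ c → proj₁ c + k) eq ⟩
        proj₁ (levelCell s′ p′) + k     ≡⟨ levelCell-row inside′ ⟩
        suc (p′ + s′)                   ≡⟨ cong (λ q → suc (q + s′)) (cong proj₂ eq) ⟨
        suc (p + s′)                    ∎))) s<s′
      where open ≡-Reasoning

  matrixCells-unique : Unique matrixCells
  matrixCells-unique = cartesianProduct⁺ (applyUpTo⁺₁ suc t (λ i<j _ → ℕ.<⇒≢ (s≤s i<j))) (upTo⁺ k)

  matrixCell∈levels : ∀ {c} → c ∈ matrixCells → c ∈ levels 1 (t + k ∸ 1)
  matrixCell∈levels {I , j} c∈ with 1≤I , I≤t , j<k ← ∈-matrixCells⁻ c∈ =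
    ∈-levels⁺ 1 (t + k ∸ 1) 1≤s′ s′<1+[t+k∸1]
      (subst (_∈ levelCells s′ 0 (t + k ∸ s′)) onLevel (∈-levelCells⁺ s′ 0 (t + k ∸ s′) z≤n j<t+k∸s′ inside))
    where
    s′ = I + k ∸ suc j
    level : suc (j + s′) ≡ I + k
    level = trans (ℕ.+-comm (suc j) s′) (ℕ.m∸n+n≡m (ℕ.≤-trans j<k (ℕ.m≤n+m k I)))
    k≤j+s′ : k ≤ j + s′
    k≤j+s′ = ℕ.≤-pred (subst (suc k ≤_) (sym level) (ℕ.+-monoˡ-≤ k 1≤I))
    inside : Inside s′ j
    inside = ℕ.m≤n+o⇒m∸n≤o k s′ (subst (k ≤_) (ℕ.+-comm j s′) k≤j+s′) , j<k
    onLevel : levelCell s′ j ≡ (I , j)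
    onLevel = cong (_, j) (trans (cong (_∸ k) level) (ℕ.m+n∸n≡m I k))
    I+k≤t+k : I + k ≤ t + k
    I+k≤t+k = ℕ.+-monoˡ-≤ k I≤t
    1≤s′ : 1 ≤ s′
    1≤s′ = ℕ.+-cancelˡ-≤ j 1 s′ (subst (_≤ j + s′) (ℕ.+-comm 1 j) (ℕ.≤-trans j<k k≤j+s′))
    s′<1+[t+k∸1] : s′ < 1 + (t + k ∸ 1)
    s′<1+[t+k∸1] = s≤s (ℕ.m+n≤o⇒m≤o∸n s′ (ℕ.≤-trans (ℕ.+-monoʳ-≤ s′ (s≤s z≤n))
                                                     (subst (_≤ t + k) (sym (trans (ℕ.+-comm s′ (suc j)) level)) I+k≤t+k)))
    j<t+k∸s′ : j < 0 + (t + k ∸ s′)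
    j<t+k∸s′ = ℕ.m+n≤o⇒m≤o∸n (suc j) (subst (_≤ t + k) (sym level) I+k≤t+k)

  levelCell∈matrix : ∀ {c} → c ∈ levels 1 (t + k ∸ 1) → c ∈ matrixCells
  levelCell∈matrix c∈
    with s′ , 1≤s′ , s′<1+[t+k∸1] , c∈s′ ← ∈-levels⁻ 1 (t + k ∸ 1) c∈
    with p , _ , p<t+k∸s′ , inside , refl ← ∈-levelCells⁻ s′ 0 (t + k ∸ s′) c∈s′ =
    ∈-matrixCells⁺ (levelCell-row≥1 inside) I≤t (proj₂ inside)
    where
    s′≤t+k : s′ ≤ t + k
    s′≤t+k = ℕ.≤-trans (ℕ.≤-pred s′<1+[t+k∸1]) (ℕ.m∸n≤m (t + k) 1)
    I≤t : proj₁ (levelCell s′ p) ≤ t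
    I≤t = ℕ.+-cancelʳ-≤ k _ t (subst (_≤ t + k) (sym (levelCell-row inside)) (ℕ.m≤o∸n⇒m+n≤o (suc p) s′≤t+k p<t+k∸s′))

  matrixCells↭levels : matrixCells ↭ levels 1 (t + k ∸ 1)
  matrixCells↭levels = ∼bag⇒↭ (unique∧set⇒bag matrixCells-unique (levels-unique 1 (t + k ∸ 1)) (mk⇔ matrixCell∈levels levelCell∈matrix))

module Levels (n k t₀ : ℕ) where
  open import Data.Nat

  import Data.Nat.Properties as ℕ
  open import Data.Bool using (true; false; if_then_else_)
  open import Data.List using (List; []; _∷_; _++_)
  open import Data.List.Membership.Propositional using (_∈_)
  open import Data.List.Relation.Binary.Permutation.Propositional as ↭ using (_↭_)
  open import Data.Product using (_×_; _,_; proj₁; proj₂)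
  open import Data.Sum using (inj₁; inj₂)
  open import Function using (_∘_)
  open import Relation.Binary.PropositionalEquality
  open import Relation.Nullary using (¬_; does; yes; no)
  open import Relation.Nullary.Decidable using (dec-true; dec-false)
  open import Data.Nat.Tactic.RingSolver using (solve-∀)
  open GelfandTsetlin using (Σℕ; Σℕ-cong; rangeSum; rangeSum-index; _◂_; boxSum; boxSum-cong; #GT; #GT-cong)
  open Grids
  open Diagonals k (suc t₀)

  t : ℕ
  t = suc t₀

  𝟙[_≤_] : ℕ → ℕ → ℕ
  𝟙[ a ≤ b ] = if does (a ℕ.≤? b) then 1 else 0

  𝟙-yes : ∀ {a b} → a ≤ b → 𝟙[ a ≤ b ] ≡ 1
  𝟙-yes {a} {b} a≤b rewrite dec-true (a ℕ.≤? b) a≤b = refl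

  𝟙-no : ∀ {a b} → b < a → 𝟙[ a ≤ b ] ≡ 0
  𝟙-no {a} {b} b<a rewrite dec-false (a ℕ.≤? b) (ℕ.<⇒≱ b<a) = refl

  cellWeight : Cell → Grid → ℕ
  cellWeight (I , j) z = 𝟙[ z (I , suc j) ≤ z (I , j) ] * 𝟙[ z (I , j) ≤ z (I ∸ 1 , j) ]

  weight : List Cell → Grid → ℕ
  weight []       z = 1
  weight (c ∷ cs) z = cellWeight c z * weight cs z

  weight-++ : ∀ cs ds z → weight (cs ++ ds) z ≡ weight cs z * weight ds z
  weight-++ []       ds z = sym (ℕ.+-identityʳ _)
  weight-++ (c ∷ cs) ds z = trans (cong (cellWeight c z *_) (weight-++ cs ds z)) (sym (ℕ.*-assoc (cellWeight c z) _ _))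

  weight-≗ : ∀ cs → Extensional (weight cs)
  weight-≗ []             z≗z′ = refl
  weight-≗ ((I , j) ∷ cs) z≗z′ =
    cong₂ _*_ (cong₂ _*_ (cong₂ 𝟙[_≤_] (z≗z′ _) (z≗z′ _)) (cong₂ 𝟙[_≤_] (z≗z′ _) (z≗z′ _))) (weight-≗ cs z≗z′)

  weight-↭ : ∀ {cs ds} → cs ↭ ds → ∀ z → weight cs z ≡ weight ds z
  weight-↭ ↭.refl         z = refl
  weight-↭ (↭.prep c p)   z = cong (cellWeight c z *_) (weight-↭ p z)
  weight-↭ (↭.swap a b p) z = trans (swap (cellWeight a z) (cellWeight b z) _) (cong (λ w → cellWeight b z * (cellWeight a z * w)) (weight-↭ p z))
    where
    swap : ∀ x y w → x * (y * w) ≡ y * (x * w)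
    swap = solve-∀
  weight-↭ (↭.trans p q)  z = trans (weight-↭ p z) (weight-↭ q z)

  gtRow : ℕ → Grid → ℕ → ℕ
  gtRow s z p = z (levelCell s p)

  -- The matrix occupies rows 1 … t and columns 0 … k - 1 of the grid; row 0 is filled with n and
  -- the columns from k on with 0, so that monotonicity of the matrix becomes local.
  Padded : Grid → Set
  Padded z = (∀ j → z (0 , j) ≡ n) × (∀ I j → 1 ≤ I → k ≤ j → z (I , j) ≡ 0) × (∀ c → z c ≤ n)

  Padded-update : ∀ {z I j v} → 1 ≤ I → j < k → v ≤ n → Padded z → Padded (z [ (I , j) ≔ v ])
  Padded-update {z} {I} {j} {v} 1≤I j<k v≤n (top , right , bounded) =
    (λ j′ → trans (update-other z _ v (0 , j′) (λ eq → ℕ.<-irrefl (cong proj₁ eq) 1≤I)) (top j′)) ,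
    (λ I′ j′ 1≤I′ k≤j′ → trans (update-other z _ v (I′ , j′) (λ eq → ℕ.<-irrefl (cong proj₂ (sym eq)) (ℕ.<-≤-trans j<k k≤j′)))
                                (right I′ j′ 1≤I′ k≤j′)) ,
    bounded′
    where
    bounded′ : ∀ c → (z [ (I , j) ≔ v ]) c ≤ n
    bounded′ c with does (c ≟ᶜ (I , j))
    ... | true  = v≤n
    ... | false = bounded c

  Padded-updateInside : ∀ {z s p v} → Inside s p → v ≤ n → Padded z → Padded (z [ levelCell s p ≔ v ])
  Padded-updateInside inside = Padded-update (levelCell-row≥1 inside) (proj₂ inside)

  levelCell-right : ∀ s p → (proj₁ (levelCell (suc s) p) , suc p) ≡ levelCell s (suc p)
  levelCell-right s p = cong (λ x → (suc x ∸ k , suc p)) (ℕ.+-suc p s)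

  levelCell-up : ∀ s p → (proj₁ (levelCell (suc s) p) ∸ 1 , p) ≡ levelCell s p
  levelCell-up s p = cong (_, p) (trans (ℕ.∸-+-assoc (suc (p + suc s)) k 1)
                                   (trans (cong (suc (p + suc s) ∸_) (ℕ.+-comm k 1)) (cong (_∸ k) (ℕ.+-suc p s))))

  -- This is where the interlacing of Gelfand–Tsetlin patterns comes from.
  cellWeight-levelCell : ∀ s p z →
    cellWeight (levelCell (suc s) p) z ≡ 𝟙[ gtRow s z (suc p) ≤ gtRow (suc s) z p ] * 𝟙[ gtRow (suc s) z p ≤ gtRow s z p ]
  cellWeight-levelCell s p z = cong₂ (λ a b → 𝟙[ z a ≤ gtRow (suc s) z p ] * 𝟙[ gtRow (suc s) z p ≤ z b ])
                                     (levelCell-right s p) (levelCell-up s p)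

  levelCell-row-mono : ∀ {a b p} → a < b → Inside b p → proj₁ (levelCell a p) < proj₁ (levelCell b p)
  levelCell-row-mono {a} {b} {p} a<b inside = begin-strict
    suc (p + a) ∸ k    ≤⟨ ℕ.∸-monoˡ-≤ k (ℕ.+-monoʳ-< p a<b) ⟩
    p + b ∸ k          <⟨ ℕ.n<1+n _ ⟩
    suc (p + b ∸ k)    ≡⟨ ℕ.+-∸-assoc 1 (Inside⇒k≤p+s inside) ⟨
    suc (p + b) ∸ k    ∎
    where open ℕ.≤-Reasoning

  levelCell-≢-lower : ∀ {a b p q} → a < b → Inside b p → levelCell b p ≢ levelCell a q
  levelCell-≢-lower a<b inside eq with refl ← cong proj₂ eq = ℕ.<-irrefl (sym (cong proj₁ eq)) (levelCell-row-mono a<b inside)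

  cellWeight-update : ∀ s p c′ z v → c′ ≢ levelCell (suc s) p → c′ ≢ levelCell s (suc p) → c′ ≢ levelCell s p →
                      cellWeight (levelCell (suc s) p) (z [ c′ ≔ v ]) ≡ cellWeight (levelCell (suc s) p) z
  cellWeight-update s p c′ z v ≢here ≢right ≢up = begin
    cellWeight (levelCell (suc s) p) (z [ c′ ≔ v ])
      ≡⟨ cellWeight-levelCell s p (z [ c′ ≔ v ]) ⟩
    𝟙[ gtRow s z′ (suc p) ≤ gtRow (suc s) z′ p ] * 𝟙[ gtRow (suc s) z′ p ≤ gtRow s z′ p ]
      ≡⟨ cong₂ (λ a b → 𝟙[ a ≤ b ] * 𝟙[ b ≤ gtRow s z′ p ]) (unchanged ≢right) (unchanged ≢here) ⟩
    𝟙[ gtRow s z (suc p) ≤ gtRow (suc s) z p ] * 𝟙[ gtRow (suc s) z p ≤ gtRow s z′ p ]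
      ≡⟨ cong (λ a → 𝟙[ gtRow s z (suc p) ≤ gtRow (suc s) z p ] * 𝟙[ gtRow (suc s) z p ≤ a ]) (unchanged ≢up) ⟩
    𝟙[ gtRow s z (suc p) ≤ gtRow (suc s) z p ] * 𝟙[ gtRow (suc s) z p ≤ gtRow s z p ]
      ≡⟨ cellWeight-levelCell s p z ⟨
    cellWeight (levelCell (suc s) p) z ∎
    where
    open ≡-Reasoning
    z′ = z [ c′ ≔ v ]
    unchanged : ∀ {c} → c′ ≢ c → z′ c ≡ z c
    unchanged c′≢c = update-other z c′ v _ (c′≢c ∘ sym)

  weight-levelCells-update : ∀ s p₀ r b p′ → suc s < b → Inside b p′ → ∀ z v →
                             weight (levelCells (suc s) p₀ r) (z [ levelCell b p′ ≔ v ]) ≡ weight (levelCells (suc s) p₀ r) z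
  weight-levelCells-update s p₀ zero    b p′ _   _      z v = refl
  weight-levelCells-update s p₀ (suc r) b p′ s+1<b inside z v with inside? (suc s) p₀
  ... | yes _ = cong₂ _*_ (cellWeight-update s p₀ _ z v (levelCell-≢-lower s+1<b inside)
                            (levelCell-≢-lower (ℕ.<-trans (ℕ.n<1+n s) s+1<b) inside) (levelCell-≢-lower (ℕ.<-trans (ℕ.n<1+n s) s+1<b) inside))
                          (weight-levelCells-update s (suc p₀) r b p′ s+1<b inside z v)
  ... | no  _ = weight-levelCells-update s (suc p₀) r b p′ s+1<b inside z v

  rangeSum-single : ∀ a (X : ℕ → ℕ) → rangeSum a a X ≡ X a
  rangeSum-single a X = trans (cong (λ m → Σℕ m (λ d → X (a + d))) (ℕ.m+n∸n≡m 1 a))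
                              (trans (ℕ.+-identityʳ _) (cong X (ℕ.+-identityʳ a)))

  Σ-𝟙-rangeSum : ∀ lo hi (X : ℕ → ℕ) → hi ≤ n → Σℕ (suc n) (λ v → 𝟙[ lo ≤ v ] * 𝟙[ v ≤ hi ] * X v) ≡ rangeSum lo hi X
  Σ-𝟙-rangeSum lo hi X hi≤n with ℕ.≤-<-connex lo hi
  ... | inj₂ hi<lo = trans (Σℕ-zero (suc n) vanish) (sym (cong (λ m → Σℕ m (λ d → X (lo + d))) (ℕ.m≤n⇒m∸n≡0 hi<lo)))
    where
    vanish : ∀ v → v < suc n → 𝟙[ lo ≤ v ] * 𝟙[ v ≤ hi ] * X v ≡ 0
    vanish v _ with ℕ.<-≤-connex v lo
    ... | inj₁ v<lo = cong (λ x → x * 𝟙[ v ≤ hi ] * X v) (𝟙-no v<lo)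
    ... | inj₂ lo≤v = trans (cong (λ x → 𝟙[ lo ≤ v ] * x * X v) (𝟙-no (ℕ.<-≤-trans hi<lo lo≤v)))
                            (cong (_* X v) (ℕ.*-zeroʳ 𝟙[ lo ≤ v ]))
  ... | inj₁ lo≤hi = begin
    Σℕ (suc n) g
      ≡⟨ cong (λ m → Σℕ m g) decomposition ⟨
    Σℕ (lo + (suc hi ∸ lo + (suc n ∸ suc hi))) g
      ≡⟨ Σℕ-++ lo _ g ⟩
    Σℕ lo g + Σℕ (suc hi ∸ lo + (suc n ∸ suc hi)) (λ d → g (lo + d))
      ≡⟨ cong (Σℕ lo g +_) (Σℕ-++ (suc hi ∸ lo) (suc n ∸ suc hi) (λ d → g (lo + d))) ⟩
    Σℕ lo g + (Σℕ (suc hi ∸ lo) (λ d → g (lo + d)) + Σℕ (suc n ∸ suc hi) (λ d → g (lo + (suc hi ∸ lo + d))))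
      ≡⟨ cong₂ (λ x y → x + (y + Σℕ (suc n ∸ suc hi) (λ d → g (lo + (suc hi ∸ lo + d)))))
               (Σℕ-zero lo (λ v v<lo → cong (λ x → x * 𝟙[ v ≤ hi ] * X v) (𝟙-no v<lo))) (Σℕ-cong (suc hi ∸ lo) inRange) ⟩
    rangeSum lo hi X + Σℕ (suc n ∸ suc hi) (λ d → g (lo + (suc hi ∸ lo + d)))
      ≡⟨ cong (rangeSum lo hi X +_) (Σℕ-zero (suc n ∸ suc hi) aboveRange) ⟩
    rangeSum lo hi X + 0
      ≡⟨ ℕ.+-identityʳ _ ⟩
    rangeSum lo hi X ∎
    where
    open ≡-Reasoning
    g : ℕ → ℕ
    g v = 𝟙[ lo ≤ v ] * 𝟙[ v ≤ hi ] * X v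
    lo≤hi+1 : lo ≤ suc hi
    lo≤hi+1 = ℕ.m≤n⇒m≤1+n lo≤hi
    decomposition : lo + (suc hi ∸ lo + (suc n ∸ suc hi)) ≡ suc n
    decomposition = trans (sym (ℕ.+-assoc lo _ _)) (trans (cong (_+ (suc n ∸ suc hi)) (ℕ.m+[n∸m]≡n lo≤hi+1)) (ℕ.m+[n∸m]≡n (s≤s hi≤n)))
    inRange : ∀ d → d < suc hi ∸ lo → g (lo + d) ≡ X (lo + d)
    inRange d d<len = trans (cong₂ (λ x y → x * y * X (lo + d)) (𝟙-yes (ℕ.m≤m+n lo d)) (𝟙-yes (rangeSum-index lo hi d d<len)))
                            (ℕ.+-identityʳ (X (lo + d)))
    aboveRange : ∀ d → d < suc n ∸ suc hi → g (lo + (suc hi ∸ lo + d)) ≡ 0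
    aboveRange d _ = trans (cong (λ x → 𝟙[ lo ≤ v ] * x * X v) (𝟙-no hi<v)) (cong (_* X v) (ℕ.*-zeroʳ 𝟙[ lo ≤ v ]))
      where
      v = lo + (suc hi ∸ lo + d)
      hi<v : hi < v
      hi<v = subst (hi <_) (ℕ.+-assoc lo (suc hi ∸ lo) d) (ℕ.≤-trans (ℕ.≤-reflexive (sym (ℕ.m+[n∸m]≡n lo≤hi+1))) (ℕ.m≤m+n _ d))

  <∸⇒+< : ∀ p b a → p < a ∸ b → p + b < a
  <∸⇒+< p zero    a       p<a = subst (_< a) (sym (ℕ.+-identityʳ p)) p<a
  <∸⇒+< p (suc b) (suc a) p<a = subst (_< suc a) (sym (ℕ.+-suc p b)) (s≤s (<∸⇒+< p b a p<a))

  gtRow-outside : ∀ s p {z z′} → Padded z → Padded z′ → ¬ Inside (suc s) p →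
                  gtRow (suc s) z′ p ≡ gtRow s z p × gtRow s z (suc p) ≡ gtRow s z p
  gtRow-outside s p {z} {z′} (top , right , _) (top′ , right′ , _) outside with p ℕ.<? k
  ... | yes p<k = trans (cong (λ I → z′ (I , p)) (row0 p+s+1<k)) (trans (top′ p) (sym levelS)) ,
                  trans (cong (λ I → z (I , suc p)) (row0 (subst (_< k) (ℕ.+-suc p s) p+s+1<k))) (trans (top (suc p)) (sym levelS))
    where
    p+s+1<k : p + suc s < k
    p+s+1<k = <∸⇒+< p (suc s) k (ℕ.≰⇒> (λ k∸s≤p → outside (k∸s≤p , p<k)))
    row0 : ∀ {x} → x < k → suc x ∸ k ≡ 0
    row0 = ℕ.m≤n⇒m∸n≡0
    levelS : gtRow s z p ≡ n
    levelS = trans (cong (λ I → z (I , p)) (row0 (ℕ.≤-trans (s≤s (ℕ.+-monoʳ-≤ p (ℕ.n≤1+n s))) p+s+1<k))) (top p)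
  ... | no  p≮k = trans (right′ _ p (rowPositive (ℕ.≤-trans k≤p (ℕ.m≤m+n p (suc s)))) k≤p) (sym levelS) ,
                  trans (right _ (suc p) (rowPositive (ℕ.≤-trans k≤p (ℕ.≤-trans (ℕ.n≤1+n p) (ℕ.m≤m+n (suc p) s)))) (ℕ.m≤n⇒m≤1+n k≤p)) (sym levelS)
    where
    k≤p : k ≤ p
    k≤p = ℕ.≮⇒≥ p≮k
    rowPositive : ∀ {x} → k ≤ x → 1 ≤ suc x ∸ k
    rowPositive k≤x = ℕ.m+n≤o⇒m≤o∸n 1 (s≤s k≤x)
    levelS : gtRow s z p ≡ 0
    levelS = right _ p (rowPositive (ℕ.≤-trans k≤p (ℕ.m≤m+n p s))) k≤p

  DependsOnFirst : ℕ → ((ℕ → ℕ) → ℕ) → Set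
  DependsOnFirst r H = ∀ ν ν′ → (∀ q → q < r → ν q ≡ ν′ q) → H ν ≡ H ν′

  LevelSum : ℕ → ℕ → ℕ → Set
  LevelSum s r p₀ = ∀ z (H : (ℕ → ℕ) → ℕ) → Padded z → DependsOnFirst r H →
    Σcells n (levelCells (suc s) p₀ r) z (λ z′ → weight (levelCells (suc s) p₀ r) z′ * H (λ q → gtRow (suc s) z′ (p₀ + q)))
    ≡ boxSum r (λ q → gtRow s z (p₀ + suc q)) (λ q → gtRow s z (p₀ + q)) H

  gtRow-update-above : ∀ {s p z v} → Inside (suc s) p → ∀ q → gtRow s (z [ levelCell (suc s) p ≔ v ]) q ≡ gtRow s z q
  gtRow-update-above {s} {p} {z} {v} inside q = update-other z (levelCell (suc s) p) v _ (levelCell-≢-lower (ℕ.n<1+n s) inside ∘ sym)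

  levelSum-fixFirst : ∀ s r p₀ → Inside (suc s) p₀ → LevelSum s r (suc p₀) → ∀ z H → Padded z → DependsOnFirst (suc r) H →
    ∀ v → v ≤ n →
    Σcells n (levelCells (suc s) (suc p₀) r) (z [ levelCell (suc s) p₀ ≔ v ])
             (λ z′ → weight (levelCells (suc s) (suc p₀) r) z′ * H (λ q → gtRow (suc s) z′ (p₀ + q)))
    ≡ boxSum r (λ q → gtRow s z (p₀ + suc (suc q))) (λ q → gtRow s z (p₀ + suc q)) (λ ν → H (v ◂ ν))
  levelSum-fixFirst s r p₀ inside restSum z H padded H-local v v≤n = begin
    Σcells n rest z₁ (λ z′ → weight rest z′ * H (λ q → gtRow (suc s) z′ (p₀ + q)))
      ≡⟨ Σcells-cong-on n rest P P-preserved (λ z′ Pz′ → cong (weight rest z′ *_) (H-local _ _ (firstIs z′ Pz′))) z₁ (padded₁ , update-same z c v) ⟩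
    Σcells n rest z₁ (λ z′ → weight rest z′ * H (v ◂ (λ q → gtRow (suc s) z′ (suc p₀ + q))))
      ≡⟨ restSum z₁ (λ ν → H (v ◂ ν)) padded₁ (λ ν ν′ ν≡ν′ → H-local _ _ (λ where zero _ → refl ; (suc q) (s≤s q<r) → ν≡ν′ q q<r)) ⟩
    boxSum r (λ q → gtRow s z₁ (suc p₀ + suc q)) (λ q → gtRow s z₁ (suc p₀ + q)) (λ ν → H (v ◂ ν))
      ≡⟨ boxSum-cong r (λ q _ → trans (gtRow-update-above {z = z} {v = v} inside _) (cong (gtRow s z) (sym (ℕ.+-suc p₀ (suc q)))))
                       (λ q _ → trans (gtRow-update-above {z = z} {v = v} inside _) (cong (gtRow s z) (sym (ℕ.+-suc p₀ q)))) (λ _ → refl) ⟩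
    boxSum r (λ q → gtRow s z (p₀ + suc (suc q))) (λ q → gtRow s z (p₀ + suc q)) (λ ν → H (v ◂ ν)) ∎
    where
    open ≡-Reasoning
    c = levelCell (suc s) p₀
    rest = levelCells (suc s) (suc p₀) r
    z₁ = z [ c ≔ v ]
    padded₁ : Padded z₁
    padded₁ = Padded-updateInside inside v≤n padded
    P : Grid → Set
    P z′ = Padded z′ × z′ c ≡ v
    P-preserved : ∀ c′ → c′ ∈ rest → ∀ z′ w → w ≤ n → P z′ → P (z′ [ c′ ≔ w ])
    P-preserved c′ c′∈ z′ w w≤n (padded′ , z′c≡v) with p′ , p₀<p′ , _ , inside′ , refl ← ∈-levelCells⁻ (suc s) (suc p₀) r c′∈ =
      Padded-updateInside inside′ w≤n padded′ , trans (update-other z′ _ w c (λ eq → ℕ.<-irrefl (cong proj₂ eq) p₀<p′)) z′c≡v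
    firstIs : ∀ z′ → P z′ → ∀ q → q < suc r → gtRow (suc s) z′ (p₀ + q) ≡ (v ◂ (λ q → gtRow (suc s) z′ (suc p₀ + q))) q
    firstIs z′ (_ , z′c≡v) zero    _ = trans (cong (gtRow (suc s) z′) (ℕ.+-identityʳ p₀)) z′c≡v
    firstIs z′ _           (suc q) _ = cong (gtRow (suc s) z′) (ℕ.+-suc p₀ q)

  levelSum-inside : ∀ s r p₀ → Inside (suc s) p₀ → LevelSum s r (suc p₀) → ∀ z H → Padded z → DependsOnFirst (suc r) H →
    Σcells n (levelCell (suc s) p₀ ∷ levelCells (suc s) (suc p₀) r) z
           (λ z′ → weight (levelCell (suc s) p₀ ∷ levelCells (suc s) (suc p₀) r) z′ * H (λ q → gtRow (suc s) z′ (p₀ + q)))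
    ≡ boxSum (suc r) (λ q → gtRow s z (p₀ + suc q)) (λ q → gtRow s z (p₀ + q)) H
  levelSum-inside s r p₀ inside restSum z H padded H-local = begin
    Σℕ (suc n) (λ v → Σcells n rest (z [ c ≔ v ]) (λ z′ → cellWeight c z′ * weight rest z′ * Hq z′))
      ≡⟨ Σℕ-cong (suc n) (λ v _ → weighFirst v) ⟩
    Σℕ (suc n) (λ v → 𝟙[ lo ≤ v ] * 𝟙[ v ≤ hi ] * Y v)
      ≡⟨ Σ-𝟙-rangeSum lo hi Y (bounded _) ⟩
    rangeSum lo hi Y
      ≡⟨ Σℕ-cong (suc hi ∸ lo) (λ d d<len → levelSum-fixFirst s r p₀ inside restSum z H padded H-local (lo + d)
                                                (ℕ.≤-trans (rangeSum-index lo hi d d<len) (bounded _))) ⟩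
    boxSum (suc r) (λ q → gtRow s z (p₀ + suc q)) (λ q → gtRow s z (p₀ + q)) H ∎
    where
    open ≡-Reasoning
    c = levelCell (suc s) p₀
    rest = levelCells (suc s) (suc p₀) r
    bounded = proj₂ (proj₂ padded)
    Hq : Grid → ℕ
    Hq z′ = H (λ q → gtRow (suc s) z′ (p₀ + q))
    lo = gtRow s z (p₀ + 1)
    hi = gtRow s z (p₀ + 0)
    Y : ℕ → ℕ
    Y v = Σcells n rest (z [ c ≔ v ]) (λ z′ → weight rest z′ * Hq z′)
    restAvoidsFirst : ∀ c′ → c′ ∈ rest → ∀ z′ v → cellWeight c (z′ [ c′ ≔ v ]) ≡ cellWeight c z′
    restAvoidsFirst c′ c′∈ z′ v with p′ , p₀<p′ , _ , inside′ , refl ← ∈-levelCells⁻ (suc s) (suc p₀) r c′∈ =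
      cellWeight-update s p₀ _ z′ v (λ eq → ℕ.<-irrefl (sym (cong proj₂ eq)) p₀<p′)
                        (levelCell-≢-lower (ℕ.n<1+n s) inside′) (levelCell-≢-lower (ℕ.n<1+n s) inside′)
    weighFirst : ∀ v → Σcells n rest (z [ c ≔ v ]) (λ z′ → cellWeight c z′ * weight rest z′ * Hq z′) ≡ 𝟙[ lo ≤ v ] * 𝟙[ v ≤ hi ] * Y v
    weighFirst v = begin
      Σcells n rest z₁ (λ z′ → cellWeight c z′ * weight rest z′ * Hq z′)
        ≡⟨ Σcells-cong n rest (λ z′ → ℕ.*-assoc (cellWeight c z′) _ _) z₁ ⟩
      Σcells n rest z₁ (λ z′ → cellWeight c z′ * (weight rest z′ * Hq z′))
        ≡⟨ Σcells-*ˡ n rest (cellWeight c) (λ z′ → weight rest z′ * Hq z′) restAvoidsFirst z₁ ⟩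
      cellWeight c z₁ * Y v
        ≡⟨ cong (_* Y v) (cellWeight-levelCell s p₀ z₁) ⟩
      𝟙[ gtRow s z₁ (suc p₀) ≤ z₁ c ] * 𝟙[ z₁ c ≤ gtRow s z₁ p₀ ] * Y v
        ≡⟨ cong₂ (λ a x → 𝟙[ a ≤ x ] * 𝟙[ x ≤ gtRow s z₁ p₀ ] * Y v)
                 (trans (gtRow-update-above {z = z} {v = v} inside (suc p₀)) (cong (gtRow s z) (ℕ.+-comm 1 p₀))) (update-same z c v) ⟩
      𝟙[ lo ≤ v ] * 𝟙[ v ≤ gtRow s z₁ p₀ ] * Y v
        ≡⟨ cong (λ b → 𝟙[ lo ≤ v ] * 𝟙[ v ≤ b ] * Y v) (trans (gtRow-update-above {z = z} {v = v} inside p₀) (cong (gtRow s z) (sym (ℕ.+-identityʳ p₀)))) ⟩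
      𝟙[ lo ≤ v ] * 𝟙[ v ≤ hi ] * Y v ∎
      where z₁ = z [ c ≔ v ]

  levelSum-outside : ∀ s r p₀ → ¬ Inside (suc s) p₀ → LevelSum s r (suc p₀) → ∀ z H → Padded z → DependsOnFirst (suc r) H →
    Σcells n (levelCells (suc s) (suc p₀) r) z (λ z′ → weight (levelCells (suc s) (suc p₀) r) z′ * H (λ q → gtRow (suc s) z′ (p₀ + q)))
    ≡ boxSum (suc r) (λ q → gtRow s z (p₀ + suc q)) (λ q → gtRow s z (p₀ + q)) H
  levelSum-outside s r p₀ outside restSum z H padded H-local = begin
    Σcells n rest z (λ z′ → weight rest z′ * H (λ q → gtRow (suc s) z′ (p₀ + q)))
      ≡⟨ Σcells-cong-on n rest Padded Padded-preserved (λ z′ padded′ → cong (weight rest z′ *_) (H-local _ _ (firstIs z′ padded′))) z padded ⟩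
    Σcells n rest z (λ z′ → weight rest z′ * H (a ◂ (λ q → gtRow (suc s) z′ (suc p₀ + q))))
      ≡⟨ restSum z (λ ν → H (a ◂ ν)) padded (λ ν ν′ ν≡ν′ → H-local _ _ (λ where zero _ → refl ; (suc q) (s≤s q<r) → ν≡ν′ q q<r)) ⟩
    boxSum r (λ q → gtRow s z (suc p₀ + suc q)) (λ q → gtRow s z (suc p₀ + q)) (λ ν → H (a ◂ ν))
      ≡⟨ boxSum-cong r (λ q _ → cong (gtRow s z) (sym (ℕ.+-suc p₀ (suc q)))) (λ q _ → cong (gtRow s z) (sym (ℕ.+-suc p₀ q))) (λ _ → refl) ⟩
    X a
      ≡⟨ rangeSum-single a X ⟨
    rangeSum a a X
      ≡⟨ cong₂ (λ l h → rangeSum l h X) lo≡a hi≡a ⟨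
    boxSum (suc r) (λ q → gtRow s z (p₀ + suc q)) (λ q → gtRow s z (p₀ + q)) H ∎
    where
    open ≡-Reasoning
    rest = levelCells (suc s) (suc p₀) r
    a = gtRow s z p₀
    X : ℕ → ℕ
    X v = boxSum r (λ q → gtRow s z (p₀ + suc (suc q))) (λ q → gtRow s z (p₀ + suc q)) (λ ν → H (v ◂ ν))
    lo≡a : gtRow s z (p₀ + 1) ≡ a
    lo≡a = trans (cong (gtRow s z) (ℕ.+-comm p₀ 1)) (proj₂ (gtRow-outside s p₀ padded padded outside))
    hi≡a : gtRow s z (p₀ + 0) ≡ a
    hi≡a = cong (gtRow s z) (ℕ.+-identityʳ p₀)
    Padded-preserved : ∀ c′ → c′ ∈ rest → ∀ z′ w → w ≤ n → Padded z′ → Padded (z′ [ c′ ≔ w ])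
    Padded-preserved c′ c′∈ z′ w w≤n padded′ with p′ , _ , _ , inside′ , refl ← ∈-levelCells⁻ (suc s) (suc p₀) r c′∈ =
      Padded-updateInside inside′ w≤n padded′
    firstIs : ∀ z′ → Padded z′ → ∀ q → q < suc r → gtRow (suc s) z′ (p₀ + q) ≡ (a ◂ (λ q → gtRow (suc s) z′ (suc p₀ + q))) q
    firstIs z′ padded′ zero    _ = trans (cong (gtRow (suc s) z′) (ℕ.+-identityʳ p₀)) (proj₁ (gtRow-outside s p₀ padded padded′ outside))
    firstIs z′ _       (suc q) _ = cong (gtRow (suc s) z′) (ℕ.+-suc p₀ q)

  levelSum : ∀ s r p₀ → LevelSum s r p₀
  levelSum s zero    p₀ z H _      H-local = trans (ℕ.+-identityʳ _) (H-local _ _ (λ q ()))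
  levelSum s (suc r) p₀ z H padded H-local with inside? (suc s) p₀
  ... | yes inside  = levelSum-inside s r p₀ inside (levelSum s r (suc p₀)) z H padded H-local
  ... | no  outside = levelSum-outside s r p₀ outside (levelSum s r (suc p₀)) z H padded H-local

  levelsSum : ∀ r s z → Padded z → s + r ≡ t₀ + k → Σcells n (levels (suc s) r) z (weight (levels (suc s) r)) ≡ #GT r (gtRow s z)
  levelsSum zero    s z _      _        = refl
  levelsSum (suc r) s z padded s+r+1≡ = begin
    Σcells n (D ++ rest) z (weight (D ++ rest))
      ≡⟨ Σcells-cong n (D ++ rest) (weight-++ D rest) z ⟩
    Σcells n (D ++ rest) z (λ z′ → weight D z′ * weight rest z′)
      ≡⟨ Σcells-++ n D rest _ z ⟩
    Σcells n D z (λ z′ → Σcells n rest z′ (λ z″ → weight D z″ * weight rest z″))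
      ≡⟨ Σcells-cong n D (λ z′ → Σcells-*ˡ n rest (weight D) (weight rest) restAvoidsD z′) z ⟩
    Σcells n D z (λ z′ → weight D z′ * Σcells n rest z′ (weight rest))
      ≡⟨ Σcells-cong-on n D Padded D-preserves (λ z′ padded′ → cong (weight D z′ *_) (levelsSum r (suc s) z′ padded′ s+1+r≡)) z padded ⟩
    Σcells n D z (λ z′ → weight D z′ * #GT r (gtRow (suc s) z′))
      ≡⟨ cong (λ m → Σcells n (levelCells (suc s) 0 m) z (λ z′ → weight (levelCells (suc s) 0 m) z′ * #GT r (gtRow (suc s) z′))) width ⟩
    Σcells n (levelCells (suc s) 0 (suc r)) z (λ z′ → weight (levelCells (suc s) 0 (suc r)) z′ * #GT r (gtRow (suc s) z′))
      ≡⟨ levelSum s (suc r) 0 z (#GT r) padded (λ ν ν′ ν≡ν′ → #GT-cong r (λ p p≤r → ν≡ν′ p (s≤s p≤r))) ⟩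
    #GT (suc r) (gtRow s z) ∎
    where
    open ≡-Reasoning
    D = levelCells (suc s) 0 (t + k ∸ suc s)
    rest = levels (suc (suc s)) r
    width : t + k ∸ suc s ≡ suc r
    width = trans (cong (_∸ s) (sym s+r+1≡)) (ℕ.m+n∸m≡n s (suc r))
    s+1+r≡ : suc s + r ≡ t₀ + k
    s+1+r≡ = trans (sym (ℕ.+-suc s r)) s+r+1≡
    restAvoidsD : ∀ c′ → c′ ∈ rest → ∀ z′ v → weight D (z′ [ c′ ≔ v ]) ≡ weight D z′
    restAvoidsD c′ c′∈ z′ v with s′ , s+2≤s′ , _ , c′∈s′ ← ∈-levels⁻ (suc (suc s)) r c′∈
                           with p′ , _ , _ , inside′ , refl ← ∈-levelCells⁻ s′ 0 (t + k ∸ s′) c′∈s′ =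
      weight-levelCells-update s 0 (t + k ∸ suc s) s′ p′ s+2≤s′ inside′ z′ v
    D-preserves : ∀ c → c ∈ D → ∀ z′ v → v ≤ n → Padded z′ → Padded (z′ [ c ≔ v ])
    D-preserves c c∈ z′ v v≤n padded′ with p , _ , _ , inside , refl ← ∈-levelCells⁻ (suc s) 0 (t + k ∸ suc s) c∈ =
      Padded-updateInside inside v≤n padded′

  matrixSum≡#GT : ∀ z → Padded z → Σcells n matrixCells z (weight matrixCells) ≡ #GT (t₀ + k) (gtRow 0 z)
  matrixSum≡#GT z padded = begin
    Σcells n matrixCells z (weight matrixCells)
      ≡⟨ Σcells-↭ n matrixCells↭levels (weight-≗ matrixCells) z ⟩
    Σcells n (levels 1 (t₀ + k)) z (weight matrixCells)
      ≡⟨ Σcells-cong n (levels 1 (t₀ + k)) (weight-↭ matrixCells↭levels) z ⟩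
    Σcells n (levels 1 (t₀ + k)) z (weight (levels 1 (t₀ + k)))
      ≡⟨ levelsSum (t₀ + k) 0 z padded refl ⟩
    #GT (t₀ + k) (gtRow 0 z) ∎
    where open ≡-Reasoning

module Matrices (n k t₀ : ℕ) where
  open import Data.Nat

  import Data.Nat.Properties as ℕ
  open import Data.Nat.ListAction using (sum)
  open import Data.Nat.ListAction.Properties using (sum-++)
  open import Data.Bool using (Bool; true; false; T; not; _∨_; if_then_else_)
  open import Data.Bool.Properties using (T-∧; T-∨; T-not-≡)
  open import Data.Fin using (Fin; toℕ; fromℕ<) renaming (zero to fzero; suc to fsuc)
  import Data.Fin.Properties as Fin
  open import Data.List using (List; []; _∷_; _++_; map; concatMap; allFin; tabulate; applyUpTo; upTo; cartesianProduct)
  import Data.List.Properties as List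
  open import Data.List.Membership.Propositional using (_∈_)
  open import Data.List.Membership.Propositional.Properties using (∈-allFin; ∈-cartesianProduct⁺)
  open import Data.List.Relation.Unary.Any using (here; there)
  open import Data.Vec using (Vec; lookup) renaming ([] to []ᵛ; _∷_ to _∷ᵛ_)
  open import Data.Empty using (⊥-elim)
  open import Data.Product using (_×_; _,_; proj₁; proj₂)
  open import Data.Sum using (_⊎_; inj₁; inj₂; map₂; [_,_]′)
  open import Function using (_∘_)
  open import Function.Bundles using (Equivalence)
  open import Relation.Binary.PropositionalEquality
  open import Relation.Nullary using (yes; no)
  open import Defs using (allVecs; all; cells; _≼ᵇ_; val; inOrderPolytope; ehrRect)
  open GelfandTsetlin using (Σℕ; #GT; #GT-cong)
  open Grids
  open Diagonals k (suc t₀) using (matrixCells; ∈-matrixCells⁻; ∈-matrixCells⁺)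
  open Levels n k t₀
  open Evaluation using (rectPartition; rectPartition-<; rectPartition-≥)

  Values : ℕ → Set
  Values m = Vec (Fin (suc n)) m

  sum-concatMap : ∀ {A B : Set} (g : B → ℕ) (f : A → List B) xs →
                  sum (map g (concatMap f xs)) ≡ sum (map (λ a → sum (map g (f a))) xs)
  sum-concatMap g f []       = refl
  sum-concatMap g f (a ∷ xs) = trans (cong sum (List.map-++ g (f a) (concatMap f xs)))
                                     (trans (sum-++ (map g (f a)) _) (cong (sum (map g (f a)) +_) (sum-concatMap g f xs)))

  sum-map-∘ : ∀ {A B : Set} (g : B → ℕ) (h : A → B) xs → sum (map g (map h xs)) ≡ sum (map (g ∘ h) xs)
  sum-map-∘ g h xs = cong sum (sym (List.map-∘ xs))

  sum-map-cong : ∀ {A : Set} {f g : A → ℕ} → (∀ a → f a ≡ g a) → ∀ xs → sum (map f xs) ≡ sum (map g xs)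
  sum-map-cong f≗g xs = cong sum (List.map-cong f≗g xs)

  sum-allFin : ∀ m (G : ℕ → ℕ) → sum (map (G ∘ toℕ) (allFin m)) ≡ Σℕ m G
  sum-allFin m G = trans (cong sum (List.map-tabulate {n = m} (λ i → i) (G ∘ toℕ))) (go m G)
    where
    go : ∀ m (G : ℕ → ℕ) → sum (tabulate {n = m} (G ∘ toℕ)) ≡ Σℕ m G
    go zero    G = refl
    go (suc m) G = cong (G 0 +_) (go m (G ∘ suc))

  rowCells : ℕ → ℕ → ℕ → List Cell
  rowCells I j zero    = []
  rowCells I j (suc m) = (I , j) ∷ rowCells I (suc j) m

  rowsFrom : ℕ → ℕ → List Cell
  rowsFrom I zero    = []
  rowsFrom I (suc m) = rowCells I 0 k ++ rowsFrom (suc I) m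

  rowCells≡ : ∀ I j m (g : ℕ → ℕ) → (∀ x → g x ≡ x + j) → rowCells I j m ≡ map (I ,_) (applyUpTo g m)
  rowCells≡ I j zero    g _  = refl
  rowCells≡ I j (suc m) g g≡ = cong₂ _∷_ (cong (I ,_) (sym (g≡ 0)))
                                       (rowCells≡ I (suc j) m (g ∘ suc) (λ x → trans (g≡ (suc x)) (sym (ℕ.+-suc x j))))

  rowsFrom≡ : ∀ I m (f : ℕ → ℕ) → (∀ x → f x ≡ x + I) → rowsFrom I m ≡ cartesianProduct (applyUpTo f m) (upTo k)
  rowsFrom≡ I zero    f _  = refl
  rowsFrom≡ I (suc m) f f≡ =
    cong₂ _++_ (trans (rowCells≡ I 0 k (λ x → x) (λ x → sym (ℕ.+-identityʳ x))) (cong (λ i → map (i ,_) (upTo k)) (sym (f≡ 0))))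
               (rowsFrom≡ (suc I) m (f ∘ suc) (λ x → trans (f≡ (suc x)) (sym (ℕ.+-suc x I))))

  rowsFrom≡matrixCells : rowsFrom 1 t ≡ matrixCells
  rowsFrom≡matrixCells = rowsFrom≡ 1 t suc (λ x → ℕ.+-comm 1 x)

  fillRow : ∀ {m} → Grid → ℕ → ℕ → Values m → Grid
  fillRow y I j []ᵛ      = y
  fillRow y I j (a ∷ᵛ r) = fillRow (y [ (I , j) ≔ toℕ a ]) I (suc j) r

  fillRows : ∀ {m} → Grid → ℕ → Vec (Values k) m → Grid
  fillRows y I []ᵛ       = y
  fillRows y I (r ∷ᵛ rs) = fillRows (fillRow y I 0 r) (suc I) rs

  sum-fillRow : ∀ m I j y (K : Grid → ℕ) →
                sum (map (λ r → K (fillRow y I j r)) (allVecs (allFin (suc n)) m)) ≡ Σcells n (rowCells I j m) y K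
  sum-fillRow zero    I j y K = ℕ.+-identityʳ _
  sum-fillRow (suc m) I j y K = begin
    sum (map (λ r → K (fillRow y I j r)) (concatMap (λ a → map (a ∷ᵛ_) (allVecs (allFin (suc n)) m)) (allFin (suc n))))
      ≡⟨ sum-concatMap (λ r → K (fillRow y I j r)) (λ a → map (a ∷ᵛ_) (allVecs (allFin (suc n)) m)) (allFin (suc n)) ⟩
    sum (map (λ a → sum (map (λ r → K (fillRow y I j r)) (map (a ∷ᵛ_) (allVecs (allFin (suc n)) m)))) (allFin (suc n)))
      ≡⟨ sum-map-cong (λ a → trans (sum-map-∘ (λ r → K (fillRow y I j r)) (a ∷ᵛ_) (allVecs (allFin (suc n)) m))
                                   (sum-fillRow m I (suc j) (y [ (I , j) ≔ toℕ a ]) K)) (allFin (suc n)) ⟩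
    sum (map (λ a → Σcells n (rowCells I (suc j) m) (y [ (I , j) ≔ toℕ a ]) K) (allFin (suc n)))
      ≡⟨ sum-allFin (suc n) (λ v → Σcells n (rowCells I (suc j) m) (y [ (I , j) ≔ v ]) K) ⟩
    Σcells n (rowCells I j (suc m)) y K ∎
    where open ≡-Reasoning

  sum-fillRows : ∀ m I y (F : Grid → ℕ) →
                 sum (map (λ x → F (fillRows y I x)) (allVecs (allVecs (allFin (suc n)) k) m)) ≡ Σcells n (rowsFrom I m) y F
  sum-fillRows zero    I y F = ℕ.+-identityʳ _
  sum-fillRows (suc m) I y F = begin
    sum (map (λ x → F (fillRows y I x)) (concatMap (λ r → map (r ∷ᵛ_) (allVecs rows m)) rows))
      ≡⟨ sum-concatMap (λ x → F (fillRows y I x)) (λ r → map (r ∷ᵛ_) (allVecs rows m)) rows ⟩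
    sum (map (λ r → sum (map (λ x → F (fillRows y I x)) (map (r ∷ᵛ_) (allVecs rows m)))) rows)
      ≡⟨ sum-map-cong (λ r → trans (sum-map-∘ (λ x → F (fillRows y I x)) (r ∷ᵛ_) (allVecs rows m))
                                   (sum-fillRows m (suc I) (fillRow y I 0 r) F)) rows ⟩
    sum (map (λ r → Σcells n (rowsFrom (suc I) m) (fillRow y I 0 r) F) rows)
      ≡⟨ sum-fillRow k I 0 y (λ z → Σcells n (rowsFrom (suc I) m) z F) ⟩
    Σcells n (rowCells I 0 k) y (λ z → Σcells n (rowsFrom (suc I) m) z F)
      ≡⟨ Σcells-++ n (rowCells I 0 k) (rowsFrom (suc I) m) F y ⟨
    Σcells n (rowsFrom I (suc m)) y F ∎
    where
    open ≡-Reasoning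
    rows = allVecs (allFin (suc n)) k

  fillRow-other : ∀ {m} y I j (r : Values m) c → proj₁ c ≢ I ⊎ proj₂ c < j → fillRow y I j r c ≡ y c
  fillRow-other y I j []ᵛ      c _       = refl
  fillRow-other y I j (a ∷ᵛ r) c outside =
    trans (fillRow-other _ I (suc j) r c (map₂ ℕ.m<n⇒m<1+n outside)) (update-other y (I , j) (toℕ a) c c≢)
    where
    c≢ : c ≢ (I , j)
    c≢ c≡ = [ (λ row≢I → row≢I (cong proj₁ c≡)) , (λ column<j → ℕ.<-irrefl (cong proj₂ c≡) column<j) ]′ outside

  fillRow-∈ : ∀ {m} y I j (r : Values m) (i : Fin m) → fillRow y I j r (I , j + toℕ i) ≡ toℕ (lookup r i)
  fillRow-∈ y I j (a ∷ᵛ r) fzero    = trans (cong (λ c → fillRow (y [ (I , j) ≔ toℕ a ]) I (suc j) r (I , c)) (ℕ.+-identityʳ j))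
                                            (trans (fillRow-other _ I (suc j) r (I , j) (inj₂ (ℕ.n<1+n j))) (update-same y (I , j) (toℕ a)))
  fillRow-∈ y I j (a ∷ᵛ r) (fsuc i) = trans (cong (λ c → fillRow (y [ (I , j) ≔ toℕ a ]) I (suc j) r (I , c)) (ℕ.+-suc j (toℕ i)))
                                            (fillRow-∈ _ I (suc j) r i)

  fillRows-above : ∀ {m} y I (x : Vec (Values k) m) c → proj₁ c < I → fillRows y I x c ≡ y c
  fillRows-above y I []ᵛ       c _   = refl
  fillRows-above y I (r ∷ᵛ rs) c c<I = trans (fillRows-above _ (suc I) rs c (ℕ.m<n⇒m<1+n c<I))
                                             (fillRow-other y I 0 r c (inj₁ (ℕ.<⇒≢ c<I)))

  fillRows-∈ : ∀ {m} y I (x : Vec (Values k) m) (i : Fin m) (j : Fin k) → fillRows y I x (I + toℕ i , toℕ j) ≡ val x (i , j)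
  fillRows-∈ y I (r ∷ᵛ rs) fzero    j = trans (cong (λ R → fillRows (fillRow y I 0 r) (suc I) rs (R , toℕ j)) (ℕ.+-identityʳ I))
                                              (trans (fillRows-above _ (suc I) rs (I , toℕ j) (ℕ.n<1+n I)) (fillRow-∈ y I 0 r j))
  fillRows-∈ y I (r ∷ᵛ rs) (fsuc i) j = trans (cong (λ R → fillRows (fillRow y I 0 r) (suc I) rs (R , toℕ j)) (ℕ.+-suc I (toℕ i)))
                                              (fillRows-∈ _ (suc I) rs i j)

  fillRow-Padded : ∀ {m} y I j (r : Values m) → 1 ≤ I → j + m ≤ k → Padded y → Padded (fillRow y I j r)
  fillRow-Padded y I j []ᵛ      _   _       padded = padded
  fillRow-Padded y I j (a ∷ᵛ r) 1≤I j+m+1≤k padded =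
    fillRow-Padded _ I (suc j) r 1≤I (subst (_≤ k) (ℕ.+-suc j _) j+m+1≤k)
      (Padded-update 1≤I (ℕ.≤-trans (ℕ.m<m+n j (s≤s z≤n)) j+m+1≤k) (ℕ.≤-pred (Fin.toℕ<n a)) padded)

  fillRows-Padded : ∀ {m} y I (x : Vec (Values k) m) → 1 ≤ I → Padded y → Padded (fillRows y I x)
  fillRows-Padded y I []ᵛ       _   padded = padded
  fillRows-Padded y I (r ∷ᵛ rs) 1≤I padded = fillRows-Padded _ (suc I) rs (ℕ.m≤n⇒m≤1+n 1≤I) (fillRow-Padded y I 0 r 1≤I ℕ.≤-refl padded)

  padding : Grid
  padding (zero  , j) = n
  padding (suc I , j) = 0

  padding-Padded : Padded padding
  padding-Padded = (λ j → refl) , (λ where (suc I) j _ _ → refl) , (λ where (zero , j) → ℕ.≤-refl ; (suc I , j) → z≤n)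

  embed : Vec (Values k) t → Grid
  embed x = fillRows padding 1 x

  Binary : ℕ → Set
  Binary w = w ≡ 0 ⊎ w ≡ 1

  *-binary : ∀ {a b} → Binary a → Binary b → Binary (a * b)
  *-binary (inj₁ refl) _           = inj₁ refl
  *-binary (inj₂ refl) (inj₁ refl) = inj₁ refl
  *-binary (inj₂ refl) (inj₂ refl) = inj₂ refl

  𝟙-binary : ∀ a b → Binary 𝟙[ a ≤ b ]
  𝟙-binary a b with ℕ.≤-<-connex a b
  ... | inj₁ a≤b = inj₂ (𝟙-yes a≤b)
  ... | inj₂ b<a = inj₁ (𝟙-no b<a)

  𝟙≡1⇒≤ : ∀ {a b} → 𝟙[ a ≤ b ] ≡ 1 → a ≤ b
  𝟙≡1⇒≤ {a} {b} 𝟙≡1 with ℕ.≤-<-connex a b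
  ... | inj₁ a≤b = a≤b
  ... | inj₂ b<a = ⊥-elim (ℕ.0≢1+n (trans (sym (𝟙-no b<a)) 𝟙≡1))

  weight-binary : ∀ cs z → Binary (weight cs z)
  weight-binary []             z = inj₂ refl
  weight-binary ((I , j) ∷ cs) z =
    *-binary (*-binary (𝟙-binary (z (I , suc j)) (z (I , j))) (𝟙-binary (z (I , j)) (z (I ∸ 1 , j)))) (weight-binary cs z)

  LocallyMonotone : Grid → Set
  LocallyMonotone z = ∀ I j → 1 ≤ I → I ≤ t → j < k → z (I , suc j) ≤ z (I , j) × z (I , j) ≤ z (I ∸ 1 , j)

  LocallyMonotone⇒weight≡1 : ∀ z → LocallyMonotone z → weight matrixCells z ≡ 1
  LocallyMonotone⇒weight≡1 z monotone = allOne matrixCells (λ c c∈ → cellOne c (∈-matrixCells⁻ c∈))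
    where
    cellOne : ∀ c → 1 ≤ proj₁ c × proj₁ c ≤ t × proj₂ c < k → cellWeight c z ≡ 1
    cellOne (I , j) (1≤I , I≤t , j<k) = cong₂ _*_ (𝟙-yes (proj₁ (monotone I j 1≤I I≤t j<k))) (𝟙-yes (proj₂ (monotone I j 1≤I I≤t j<k)))
    allOne : ∀ cs → (∀ c → c ∈ cs → cellWeight c z ≡ 1) → weight cs z ≡ 1
    allOne []       _    = refl
    allOne (c ∷ cs) ones = cong₂ _*_ (ones c (here refl)) (allOne cs (λ c′ c′∈ → ones c′ (there c′∈)))

  weight≡1⇒LocallyMonotone : ∀ z → weight matrixCells z ≡ 1 → LocallyMonotone z
  weight≡1⇒LocallyMonotone z w≡1 I j 1≤I I≤t j<k =
    𝟙≡1⇒≤ (ℕ.m*n≡1⇒m≡1 𝟙[ z (I , suc j) ≤ z (I , j) ] _ cell≡1) , 𝟙≡1⇒≤ (ℕ.m*n≡1⇒n≡1 𝟙[ z (I , suc j) ≤ z (I , j) ] _ cell≡1)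
    where
    eachOne : ∀ cs → weight cs z ≡ 1 → ∀ c → c ∈ cs → cellWeight c z ≡ 1
    eachOne (c ∷ cs) w≡1 .c (here refl) = ℕ.m*n≡1⇒m≡1 (cellWeight c z) (weight cs z) w≡1
    eachOne (c ∷ cs) w≡1 c′ (there c′∈) = eachOne cs (ℕ.m*n≡1⇒n≡1 (cellWeight c z) (weight cs z) w≡1) c′ c′∈
    cell≡1 : cellWeight (I , j) z ≡ 1
    cell≡1 = eachOne matrixCells w≡1 (I , j) (∈-matrixCells⁺ 1≤I I≤t j<k)

  T-all : ∀ {A : Set} (p : A → Bool) xs → T (all p xs) → ∀ x → x ∈ xs → T (p x)
  T-all p (y ∷ xs) T-all-p x (here refl) = proj₁ (Equivalence.to T-∧ T-all-p)
  T-all p (y ∷ xs) T-all-p x (there x∈)  = T-all p xs (proj₂ (Equivalence.to T-∧ T-all-p)) x x∈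

  all-T : ∀ {A : Set} (p : A → Bool) xs → (∀ x → T (p x)) → T (all p xs)
  all-T p []       _   = _
  all-T p (y ∷ xs) T-p = Equivalence.from T-∧ (T-p y , all-T p xs T-p)

  Monotone : Vec (Values k) t → Set
  Monotone x = ∀ s s′ → T (s ≼ᵇ s′) → val x s ≤ val x s′

  ∈-cells : ∀ c → c ∈ cells t k
  ∈-cells (i , j) = ∈-cartesianProduct⁺ (∈-allFin i) (∈-allFin j)

  inOrderPolytope⇒Monotone : ∀ x → T (inOrderPolytope x) → Monotone x
  inOrderPolytope⇒Monotone x inside s s′ s≼s′
    with Equivalence.to T-∨ (T-all _ (cells t k) (T-all _ (cells t k) inside s (∈-cells s)) s′ (∈-cells s′))
  ... | inj₁ T-not = ⊥-elim (subst T (Equivalence.to T-not-≡ T-not) s≼s′)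
  ... | inj₂ T-≤   = ℕ.≤ᵇ⇒≤ _ _ T-≤

  Monotone⇒inOrderPolytope : ∀ x → Monotone x → T (inOrderPolytope x)
  Monotone⇒inOrderPolytope x monotone = all-T _ (cells t k) (λ s → all-T _ (cells t k) (pairOk s))
    where
    pairOk : ∀ s s′ → T (not (s ≼ᵇ s′) ∨ (val x s ≤ᵇ val x s′))
    pairOk s s′ with s ≼ᵇ s′ in s≼s′
    ... | false = _
    ... | true  = ℕ.≤⇒≤ᵇ (monotone s s′ (subst T (sym s≼s′) _))

  ≼ᵇ-intro : ∀ {i i′ : Fin t} {j j′ : Fin k} → toℕ i′ ≤ toℕ i → toℕ j′ ≤ toℕ j → T ((i , j) ≼ᵇ (i′ , j′))
  ≼ᵇ-intro i′≤i j′≤j = Equivalence.from T-∧ (ℕ.≤⇒≤ᵇ i′≤i , ℕ.≤⇒≤ᵇ j′≤j)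

  ≼ᵇ-elim : ∀ {i i′ : Fin t} {j j′ : Fin k} → T ((i , j) ≼ᵇ (i′ , j′)) → toℕ i′ ≤ toℕ i × toℕ j′ ≤ toℕ j
  ≼ᵇ-elim {i} {i′} {j} {j′} i,j≼i′,j′ with T-i , T-j ← Equivalence.to T-∧ i,j≼i′,j′ = ℕ.≤ᵇ⇒≤ _ _ T-i , ℕ.≤ᵇ⇒≤ _ _ T-j

  module _ (x : Vec (Values k) t) where

    private
      z = embed x

    embed-Padded : Padded z
    embed-Padded = fillRows-Padded padding 1 x (s≤s z≤n) padding-Padded

    embed-value : ∀ i j (i<t : i < t) (j<k : j < k) → z (suc i , j) ≡ val x (fromℕ< i<t , fromℕ< j<k)
    embed-value i j i<t j<k = trans (cong₂ (λ a b → z (suc a , b)) (sym (Fin.toℕ-fromℕ< i<t)) (sym (Fin.toℕ-fromℕ< j<k)))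
                                    (fillRows-∈ padding 1 x (fromℕ< i<t) (fromℕ< j<k))

    Monotone⇒LocallyMonotone : Monotone x → LocallyMonotone z
    Monotone⇒LocallyMonotone monotone (suc i) j _ i<t j<k = rightward , upward i i<t
      where
      dominated : ∀ {i i′ j j′} (i<t : i < t) (i′<t : i′ < t) (j<k : j < k) (j′<k : j′ < k) → i′ ≤ i → j′ ≤ j →
                z (suc i , j) ≤ z (suc i′ , j′)
      dominated i<t i′<t j<k j′<k i′≤i j′≤j =
        subst₂ _≤_ (sym (embed-value _ _ i<t j<k)) (sym (embed-value _ _ i′<t j′<k))
          (monotone _ _ (≼ᵇ-intro (subst₂ _≤_ (sym (Fin.toℕ-fromℕ< i′<t)) (sym (Fin.toℕ-fromℕ< i<t)) i′≤i)
                                  (subst₂ _≤_ (sym (Fin.toℕ-fromℕ< j′<k)) (sym (Fin.toℕ-fromℕ< j<k)) j′≤j)))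
      rightward : z (suc i , suc j) ≤ z (suc i , j)
      rightward with suc j ℕ.<? k
      ... | yes j+1<k = dominated i<t i<t j+1<k j<k ℕ.≤-refl (ℕ.n≤1+n j)
      ... | no  j+1≮k = subst (_≤ z (suc i , j)) (sym (proj₁ (proj₂ embed-Padded) (suc i) (suc j) (s≤s z≤n) (ℕ.≮⇒≥ j+1≮k))) z≤n
      upward : ∀ i → i < t → z (suc i , j) ≤ z (i , j)
      upward zero     _   = subst (z (1 , j) ≤_) (sym (proj₁ embed-Padded j)) (proj₂ (proj₂ embed-Padded) _)
      upward (suc i′) i<t = dominated i<t (ℕ.<-trans (ℕ.n<1+n i′) i<t) j<k j<k (ℕ.n≤1+n i′) ℕ.≤-refl

    LocallyMonotone⇒Monotone : LocallyMonotone z → Monotone x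
    LocallyMonotone⇒Monotone local (i , j) (i′ , j′) s≼s′ with i′≤i , j′≤j ← ≼ᵇ-elim {i} {i′} {j} {j′} s≼s′ =
      subst₂ _≤_ (fillRows-∈ padding 1 x i j) (fillRows-∈ padding 1 x i′ j′) (ℕ.≤-trans alongRow′ alongColumn′)
      where
      a = toℕ i
      c = toℕ i′
      d = toℕ j′
      alongRow : ∀ I → 1 ≤ I → I ≤ t → ∀ d e → d + e < k → z (I , d + e) ≤ z (I , d)
      alongRow I _   _   d zero    _       = ℕ.≤-reflexive (cong (λ b → z (I , b)) (ℕ.+-identityʳ d))
      alongRow I 1≤I I≤t d (suc e) d+e+1<k =
        ℕ.≤-trans (subst (λ b → z (I , b) ≤ z (I , d + e)) (sym (ℕ.+-suc d e)) (proj₁ (local I (d + e) 1≤I I≤t d+e<k)))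
                  (alongRow I 1≤I I≤t d e d+e<k)
        where
        d+e<k : d + e < k
        d+e<k = ℕ.<-trans (ℕ.n<1+n _) (subst (_< k) (ℕ.+-suc d e) d+e+1<k)
      alongColumn : ∀ c e j → j < k → c + e < t → z (suc (c + e) , j) ≤ z (suc c , j)
      alongColumn c zero    j _   _         = ℕ.≤-reflexive (cong (λ I → z (suc I , j)) (ℕ.+-identityʳ c))
      alongColumn c (suc e) j j<k c+e+1<t =
        ℕ.≤-trans (proj₂ (local (suc (c + suc e)) j (s≤s z≤n) c+e+1<t j<k))
                  (subst (λ I → z (I , j) ≤ z (suc c , j)) (sym (ℕ.+-suc c e)) (alongColumn c e j j<k (ℕ.<-trans (ℕ.n<1+n _) bound)))
        where
        bound : suc (c + e) < t
        bound = subst (_< t) (ℕ.+-suc c e) c+e+1<t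
      alongRow′ : z (suc a , toℕ j) ≤ z (suc a , d)
      alongRow′ = subst (λ b → z (suc a , b) ≤ z (suc a , d)) (ℕ.m+[n∸m]≡n j′≤j)
                        (alongRow (suc a) (s≤s z≤n) (Fin.toℕ<n i) d (toℕ j ∸ d) (subst (_< k) (sym (ℕ.m+[n∸m]≡n j′≤j)) (Fin.toℕ<n j)))
      alongColumn′ : z (suc a , d) ≤ z (suc c , d)
      alongColumn′ = subst (λ I → z (suc I , d) ≤ z (suc c , d)) (ℕ.m+[n∸m]≡n i′≤i)
                           (alongColumn c (a ∸ c) d (Fin.toℕ<n j′) (subst (_< t) (sym (ℕ.m+[n∸m]≡n i′≤i)) (Fin.toℕ<n i)))

    indicator≡weight : (if inOrderPolytope x then 1 else 0) ≡ weight matrixCells z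
    indicator≡weight with inOrderPolytope x in eq
    ... | true  = sym (LocallyMonotone⇒weight≡1 z (Monotone⇒LocallyMonotone (inOrderPolytope⇒Monotone x (subst T (sym eq) _))))
    ... | false with weight-binary matrixCells z
    ...   | inj₁ w≡0 = sym w≡0
    ...   | inj₂ w≡1 = ⊥-elim (subst T eq (Monotone⇒inOrderPolytope x (LocallyMonotone⇒Monotone (weight≡1⇒LocallyMonotone z w≡1))))

  ehrRect≡#GT : ehrRect t k n ≡ #GT (t₀ + k) (rectPartition n k)
  ehrRect≡#GT = begin
    ehrRect t k n
      ≡⟨ sum-map-cong indicator≡weight (allVecs (allVecs (allFin (suc n)) k) t) ⟩
    sum (map (λ x → weight matrixCells (embed x)) (allVecs (allVecs (allFin (suc n)) k) t))
      ≡⟨ sum-fillRows t 1 padding (weight matrixCells) ⟩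
    Σcells n (rowsFrom 1 t) padding (weight matrixCells)
      ≡⟨ cong (λ cs → Σcells n cs padding (weight matrixCells)) rowsFrom≡matrixCells ⟩
    Σcells n matrixCells padding (weight matrixCells)
      ≡⟨ matrixSum≡#GT padding padding-Padded ⟩
    #GT (t₀ + k) (gtRow 0 padding)
      ≡⟨ #GT-cong (t₀ + k) (λ p _ → topLevel p) ⟩
    #GT (t₀ + k) (rectPartition n k) ∎
    where
    open ≡-Reasoning
    topLevel : ∀ p → gtRow 0 padding p ≡ rectPartition n k p
    topLevel p with p ℕ.<? k
    ... | yes p<k = trans (cong (λ I → padding (I , p)) (ℕ.m≤n⇒m∸n≡0 (subst (_≤ k) (cong suc (sym (ℕ.+-identityʳ p))) p<k)))
                          (sym (rectPartition-< n k p p<k))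
    ... | no  p≮k = trans (cong (λ I → padding (I , p)) (trans (cong (λ q → suc q ∸ k) (ℕ.+-identityʳ p)) (ℕ.+-∸-assoc 1 (ℕ.≮⇒≥ p≮k))))
                          (sym (rectPartition-≥ n k p (ℕ.≮⇒≥ p≮k)))

module Fractions where
  open import Data.Nat hiding (_/_)
  open import Data.Integer using (+_)
  import Data.Integer.Properties as ℤ
  open import Data.Rational as ℚ using (ℚ; 1ℚ; fromℚᵘ)
  import Data.Rational.Properties as ℚ
  open import Data.Rational.Unnormalised as ℚᵘ using (mkℚᵘ; *≡*)
  import Data.Rational.Unnormalised.Properties as ℚᵘ
  open import Data.List using (foldr; applyUpTo)
  open import Function using (_∘_)
  open import Relation.Binary.PropositionalEquality
  open import Defs using (_/ℕ_)
  open Products using (Πℕ; Πℕ-nonZero)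

  fromℚᵘ-* : ∀ p q → fromℚᵘ p ℚ.* fromℚᵘ q ≡ fromℚᵘ (p ℚᵘ.* q)
  fromℚᵘ-* p q = trans (sym (ℚ.fromℚᵘ-toℚᵘ _))
    (ℚ.fromℚᵘ-cong (ℚᵘ.≃-trans (ℚ.toℚᵘ-homo-* (fromℚᵘ p) (fromℚᵘ q)) (ℚᵘ.*-cong (ℚ.toℚᵘ-fromℚᵘ p) (ℚ.toℚᵘ-fromℚᵘ q))))

  /ℕ-* : ∀ a b c d → .{{NonZero b}} → .{{NonZero d}} → (a /ℕ b) ℚ.* (c /ℕ d) ≡ (a * c) /ℕ (b * d)
  /ℕ-* a (suc b) c (suc d) = trans (fromℚᵘ-* (mkℚᵘ (+ a) b) (mkℚᵘ (+ c) d)) (cong (λ m → fromℚᵘ (mkℚᵘ m _)) (sym (ℤ.pos-* a c)))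

  /ℕ-cross : ∀ a b c d → .{{NonZero b}} → .{{NonZero d}} → a * d ≡ c * b → a /ℕ b ≡ c /ℕ d
  /ℕ-cross a (suc b) c (suc d) ad≡cb =
    ℚ.fromℚᵘ-cong {mkℚᵘ (+ a) b} {mkℚᵘ (+ c) d} (*≡* (trans (sym (ℤ.pos-* a (suc d))) (trans (cong +_ ad≡cb) (ℤ.pos-* c (suc b)))))

  foldr-/ℕ : ∀ m (g : ℕ → ℕ) (F : ℕ → ℚ) (a b : ℕ → ℕ) → (∀ i → i < m → F (g i) ≡ a (g i) /ℕ b (g i)) →
             (∀ i → i < m → NonZero (b (g i))) → foldr (λ i acc → F i ℚ.* acc) 1ℚ (applyUpTo g m) ≡ Πℕ m (a ∘ g) /ℕ Πℕ m (b ∘ g)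
  foldr-/ℕ zero    g F a b _  _   = refl
  foldr-/ℕ (suc m) g F a b F≡ b≢0 = begin
    F (g 0) ℚ.* foldr (λ i acc → F i ℚ.* acc) 1ℚ (applyUpTo (g ∘ suc) m)
      ≡⟨ cong₂ ℚ._*_ (F≡ 0 (s≤s z≤n)) (foldr-/ℕ m (g ∘ suc) F a b (λ i i<m → F≡ (suc i) (s≤s i<m)) (λ i i<m → b≢0 (suc i) (s≤s i<m))) ⟩
    (a (g 0) /ℕ b (g 0)) ℚ.* (Πℕ m (a ∘ g ∘ suc) /ℕ Πℕ m (b ∘ g ∘ suc))
      ≡⟨ /ℕ-* (a (g 0)) (b (g 0)) _ _ {{b≢0 0 (s≤s z≤n)}} {{Πℕ-nonZero m (b ∘ g ∘ suc) (λ i i<m → b≢0 (suc i) (s≤s i<m))}} ⟩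
    Πℕ (suc m) (a ∘ g) /ℕ Πℕ (suc m) (b ∘ g) ∎
    where open ≡-Reasoning

module MacMahon where
  open import Data.Nat hiding (_/_)
  open import Data.Nat.Properties
  open import Data.Nat.Combinatorics using (_C_)
  open import Data.Integer using (+_)
  open import Data.Rational as ℚ using (_/_)
  open import Relation.Binary.PropositionalEquality
  open import Defs using (_/ℕ_; ehrRect; rectFormula)
  open Products using (Πℕ; Πℕ-cong)
  open GelfandTsetlin using (#GT)
  open Evaluation using (rectPartition)
  open ProductFormula using (#GT-rectPartition-product)
  open Fractions using (/ℕ-*; foldr-/ℕ)

  numerator : ℕ → ℕ → ℕ → ℕ → ℕ
  numerator t k n i = ((n + t + k ∸ 1) C (n + i)) * i !

  denominator : ℕ → ℕ → ℕ → ℕ → ℕ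
  denominator t k n i = (n + t + k ∸ i ∸ 1) ^ (k ∸ i ∸ 1)

  private
    n+[1+s]+k∸i∸1≡ : ∀ n s k i → i < k → n + suc s + k ∸ i ∸ 1 ≡ n + (s + k ∸ i)
    n+[1+s]+k∸i∸1≡ n s k i i<k = begin
      n + suc s + k ∸ i ∸ 1        ≡⟨ cong (λ x → x + k ∸ i ∸ 1) (+-suc n s) ⟩
      suc (n + s + k) ∸ i ∸ 1      ≡⟨ ∸-+-assoc (suc (n + s + k)) i 1 ⟩
      suc (n + s + k) ∸ (i + 1)    ≡⟨ cong (suc (n + s + k) ∸_) (+-comm i 1) ⟩
      n + s + k ∸ i                ≡⟨ cong (_∸ i) (+-assoc n s k) ⟩
      n + (s + k) ∸ i              ≡⟨ +-∸-assoc n (≤-trans (<⇒≤ i<k) (m≤n+m k s)) ⟩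
      n + (s + k ∸ i)              ∎
      where open ≡-Reasoning

    k∸i∸1≡k∸[1+i] : ∀ k i → k ∸ i ∸ 1 ≡ k ∸ suc i
    k∸i∸1≡k∸[1+i] k i = trans (∸-+-assoc k i 1) (cong (k ∸_) (+-comm i 1))

  denominator-nonZero : ∀ t k n i → t ≥ 1 → i < k → NonZero (denominator t k n i)
  denominator-nonZero (suc s) k n i _ i<k =
    subst NonZero (sym (cong (_^ (k ∸ i ∸ 1)) (n+[1+s]+k∸i∸1≡ n s k i i<k))) (m^n≢0 _ (k ∸ i ∸ 1) {{>-nonZero base>0}})
    where
    base>0 : n + (s + k ∸ i) > 0
    base>0 = ≤-trans (≤-trans (m<n⇒0<n∸m i<k) (∸-monoˡ-≤ i (m≤n+m k s))) (m≤n+m _ n)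

  ehrRect-product : ∀ t k n → t ≥ 1 → ehrRect t k n * Πℕ k (denominator t k n) ≡ Πℕ k (numerator t k n)
  ehrRect-product (suc s) k n _ = begin
    ehrRect (suc s) k n * Πℕ k (denominator (suc s) k n)
      ≡⟨ cong₂ _*_ (Matrices.ehrRect≡#GT n k s)
                   (Πℕ-cong k (λ i i<k → cong₂ _^_ (n+[1+s]+k∸i∸1≡ n s k i i<k) (k∸i∸1≡k∸[1+i] k i))) ⟩
    #GT (s + k) (rectPartition n k) * Πℕ k (λ i → (n + (s + k ∸ i)) ^ (k ∸ suc i))
      ≡⟨ #GT-rectPartition-product s k n ⟩
    Πℕ k (λ i → ((n + (s + k)) C (n + i)) * i !)
      ≡⟨ Πℕ-cong k (λ i _ → cong (λ N → (N C (n + i)) * i !) (trans (cong (λ x → x + k ∸ 1) (+-suc n s)) (+-assoc n s k))) ⟨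
    Πℕ k (numerator (suc s) k n) ∎
    where open ≡-Reasoning

  rectFormula≡fraction : ∀ t k n → t ≥ 1 → rectFormula t k n ≡ Πℕ k (numerator t k n) /ℕ Πℕ k (denominator t k n)
  rectFormula≡fraction t k n t≥1 =
    foldr-/ℕ k (λ i → i) _ (numerator t k n) (denominator t k n) factor≡ (λ i → denominator-nonZero t k n i t≥1)
    where
    factor≡ : ∀ i → i < k → ((+ ((n + t + k ∸ 1) C (n + i))) / 1) ℚ.* ((i !) /ℕ denominator t k n i) ≡ numerator t k n i /ℕ denominator t k n i
    factor≡ i i<k = trans (/ℕ-* ((n + t + k ∸ 1) C (n + i)) 1 (i !) (denominator t k n i) {{_}} {{denominator-nonZero t k n i t≥1 i<k}})
                          (cong (numerator t k n i /ℕ_) (+-identityʳ (denominator t k n i)))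

open import Defs
open import Data.Nat using (ℕ; _≥_)
open import Data.Nat.Properties using (*-identityʳ)
open import Data.Integer using (+_)
open import Data.Rational using (ℚ; _/_)
open import Relation.Binary.PropositionalEquality using (_≡_; trans; sym; module ≡-Reasoning)
open Products using (Πℕ; Πℕ-nonZero)
open Fractions using (/ℕ-cross)
open MacMahon using (numerator; denominator; denominator-nonZero; ehrRect-product; rectFormula≡fraction)

proposition5p13 : (k t n : ℕ) → k ≥ 1 → t ≥ 1 →
    (+ ehrRect t k n) / 1 ≡ rectFormula t k n
proposition5p13 k t n _ t≥1 = begin
  (+ ehrRect t k n) / 1
    ≡⟨ /ℕ-cross (ehrRect t k n) 1 (Πℕ k (numerator t k n)) (Πℕ k (denominator t k n))
                {{_}} {{Πℕ-nonZero k (denominator t k n) (λ i → denominator-nonZero t k n i t≥1)}}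
                (trans (ehrRect-product t k n t≥1) (sym (*-identityʳ _))) ⟩
  Πℕ k (numerator t k n) /ℕ Πℕ k (denominator t k n)
    ≡⟨ rectFormula≡fraction t k n t≥1 ⟨
  rectFormula t k n ∎
  where open ≡-Reasoning
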